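{- Let $R_1,R_2$ be the unique formal power series in $t$ with coefficients in $\mathbb{Q}[z_1,z_2,\ldots]$ such that $R_1=\frac t2\sum_{i\ge1}z_i[u^{i-1}]R^{ -1/2}$ and $R_2=t-3R_1^2+\frac t2\sum_{i\ge1}z_i[u^i]R^{ -1/2}$, where $R=1-4uR_1-4u^2R_2$, and let $\beta=\sum_{i\ge1}z_iu^{ -i}$. Let $S_1,S_2$ be the unique formal power series in $t$ with coefficients in $\mathbb{Q}[z_1,z_2,\ldots]$ such that $S_1=t[v^0]W$ and $S_2=t+t[v^{ -1}]W$, where $W=\sum_{i\ge1}z_iP^{i-1}$ and $P=v+S_1+S_2/v$. Then: (i) $S_1=2R_1$ and $S_2=R_2+R_1^2$; moreover, for all $\ell\ge0$, $[u^\ell]\frac{\beta}{\sqrt R}=[v^0]P^{\ell+1}W$. (ii) For all $k\ge0$ and $j\in\mathbb{Z}$, $$[v^j]P^{k+1}W=[v^{j-1}]P^kW+S_1[v^j]P^kW+S_2[v^{j+1}]P^kW,\qquad [v^j]P^kW=S_2^{ -j}[v^{ -j}]P^kW;$$ these identities allow one to express any $[v^j]P^kW$ as a linear combination of the terms $[v^{ -i}]W$, $i\ge0$, with coefficients in $\mathbb{Q}(S_1,S_2)$. (iii) Take the expression $tG=\frac1t(R_2+R_1^2)(3R_2+15R_1^2-2t)+R_1[u]\frac{\beta}{\sqrt R}-\frac12[u^2]\frac{\beta}{\sqrt R}$, rewrite it in terms of $S_1,S_2$ and $P$ using (i), then in terms of $S_1,S_2$ and the $[v^{ -i}]W$, $i\ge0$,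 using (ii), and finally replace $[v^0]W$ by $S_1/t$ and $[v^{ -1}]W$ by $(S_2-t)/t$. The resulting expression is $S_1^2+S_2-2S_1[v^{ -2}]W-[v^{ -3}]W$.
   Context: $[u^j]$ and $[v^j]$ denote coefficient extraction; $R^{ -1/2}$ is expanded as a power series in $u$; $P^kW$ is a series in $v,v^{ -1}$ whose coefficients are well-defined formal power series in $t$. The series $tG$ in (iii) is $t$ times the generating function of rooted planar maps counted by edges ($t$) and faces of degree $i$ ($z_i$). -}

module Defs where

open import Data.Nat as ℕ using (ℕ; zero; suc; _∸_)
open import Data.Integer as ℤ using (ℤ; +_; -[1+_])
open import Data.Rational as ℚ using (ℚ; 0ℚ; 1ℚ; ½)
open import Data.List using (List; []; _∷_; _++_; reverse; map; concatMap; length; zipWith; upTo; foldr; replicate)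
open import Data.Maybe using (Maybe; just; nothing; maybe)
open import Data.Product using (_×_; _,_)
open import Relation.Binary.PropositionalEquality using (_≡_)

-- Monomials in z₁, z₂, … : canonical finite exponent vectors.
-- nothing            = the empty monomial 1
-- just (p , k)       = exponent list  p ++ [suc k]   (list index 0 ↔ z₁)
-- (so the last listed exponent is nonzero: each monomial has a unique code)

Mono : Set
Mono = Maybe (List ℕ × ℕ)

toList : Mono → List ℕ
toList nothing        = []
toList (just (p , k)) = p ++ (suc k ∷ [])

normRev : List ℕ → Mono
normRev []          = nothing
normRev (zero ∷ r)  = normRev r
normRev (suc k ∷ r) = just (reverse r , k)

fromList : List ℕ → Mono
fromList l = normRev (reverse l)

-- Formal power series in t with coefficients in ℚ[z₁,z₂,…]
-- (more precisely: elements of ℚ[[t, z₁, z₂, …]], monomial ↦ coefficient;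
--  ℚ[z₁,z₂,…][[t]] is the subring where each t-coefficient has finite support)

Ser : Set
Ser = ℕ → Mono → ℚ

infix 4 _≈_
_≈_ : Ser → Ser → Set
A ≈ B = ∀ n m → A n m ≡ B n m

sumℚ : List ℚ → ℚ
sumℚ = foldr ℚ._+_ 0ℚ

cst : ℚ → Ser
cst c zero nothing = c
cst c _    _       = 0ℚ

0S 1S : Ser
0S = cst 0ℚ
1S = cst 1ℚ

tS : Ser
tS (suc zero) nothing = 1ℚ
tS _          _       = 0ℚ

infixl 6 _⊕_ _⊖_
infixl 7 _⊛_ _·_

_⊕_ : Ser → Ser → Ser
(A ⊕ B) n m = A n m ℚ.+ B n m

_⊖_ : Ser → Ser → Ser
(A ⊖ B) n m = A n m ℚ.- B n m

_·_ : ℚ → Ser → Ser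
(c · A) n m = c ℚ.* A n m

divs : List ℕ → List (List ℕ)
divs []       = [] ∷ []
divs (e ∷ es) = concatMap (λ d → map (d ∷_) (divs es)) (upTo (suc e))

_⊛_ : Ser → Ser → Ser
(A ⊛ B) n m =
  sumℚ (concatMap (λ n₁ →
    map (λ d → A n₁ (fromList d) ℚ.* B (n ∸ n₁) (fromList (zipWith _∸_ (toList m) d)))
        (divs (toList m)))
    (upTo (suc n)))

_^S_ : Ser → ℕ → Ser
A ^S zero  = 1S
A ^S suc k = A ⊛ (A ^S k)

decAt : ℕ → List ℕ → Maybe (List ℕ)
decAt _       []          = nothing
decAt zero    (zero ∷ r)  = nothing
decAt zero    (suc e ∷ r) = just (e ∷ r)
decAt (suc i) (e ∷ r)     = Data.Maybe.map (e ∷_) (decAt i r)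
  where import Data.Maybe

-- The (z-adically convergent) infinite sum  Σ_{i≥1} z_i · X i :
-- its coefficient at t^n·m is Σ over the z_i dividing m of [t^n · m/z_i] X i.
zSum : (ℕ → Ser) → Ser
zSum X n m =
  sumℚ (map (λ idx → maybe (λ e' → X (suc idx) n (fromList e')) 0ℚ (decAt idx (toList m)))
            (upTo (length (toList m))))

USer : Set
USer = ℕ → Ser

sumS : List Ser → Ser
sumS = foldr _⊕_ 0S

_⊛u_ : USer → USer → USer
(F ⊛u G) k = sumS (map (λ a → F a ⊛ G (k ∸ a)) (upTo (suc k)))

oneU : USer
oneU zero    = 1S
oneU (suc _) = 0S

_^u_ : USer → ℕ → USer
F ^u zero  = oneU
F ^u suc k = F ⊛u (F ^u k)

gbinom : ℚ → ℕ → ℚ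
gbinom α zero    = 1ℚ
gbinom α (suc k) = gbinom α k ℚ.* (α ℚ.- (+ k ℚ./ 1)) ℚ.* (+ 1 ℚ./ suc k)

-- R - 1 = -4 u R₁ - 4 u² R₂
Rm1 : Ser → Ser → USer
Rm1 R₁ R₂ (suc zero)       = (ℚ.- (+ 4 ℚ./ 1)) · R₁
Rm1 R₁ R₂ (suc (suc zero)) = (ℚ.- (+ 4 ℚ./ 1)) · R₂
Rm1 R₁ R₂ _                = 0S

-- [u^ℓ] R^{-1/2} = Σ_k binom(-1/2,k) [u^ℓ](R-1)^k
-- (terms with k > ℓ vanish since R - 1 has no constant term in u)
invSqrtR : Ser → Ser → ℕ → Ser
invSqrtR R₁ R₂ ℓ = sumS (map (λ k → gbinom (ℚ.- ½) k · (Rm1 R₁ R₂ ^u k) ℓ) (upTo (suc ℓ)))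

-- [u^ℓ] β/√R  with β = Σ_{i≥1} z_i u^{-i}
betaR : Ser → Ser → ℕ → Ser
betaR R₁ R₂ ℓ = zSum (λ i → invSqrtR R₁ R₂ (ℓ ℕ.+ i))

LSer : Set
LSer = ℤ → Ser

-- multiplication by the Laurent polynomial P = v + S₁ + S₂/v
mulP : Ser → Ser → LSer → LSer
mulP S₁ S₂ X j = X (ℤ.pred j) ⊕ S₁ ⊛ X j ⊕ S₂ ⊛ X (ℤ.suc j)

δ₀ : LSer
δ₀ (+ zero) = 1S
δ₀ _        = 0S

Ppow : Ser → Ser → ℕ → LSer
Ppow S₁ S₂ zero    = δ₀
Ppow S₁ S₂ (suc k) = mulP S₁ S₂ (Ppow S₁ S₂ k)

W : Ser → Ser → LSer
W S₁ S₂ j = zSum (λ i → Ppow S₁ S₂ (i ∸ 1) j)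

PkW : Ser → Ser → ℕ → LSer
PkW S₁ S₂ zero    = W S₁ S₂
PkW S₁ S₂ (suc k) = mulP S₁ S₂ (PkW S₁ S₂ k)

neg : ℕ → ℤ
neg n = ℤ.- (+ n)

-- Euler derivatives turn both u·d/du of R^{-1/2} (via R·(R^{-1/2})′ = −½·R′·R^{-1/2}) and v·d/dv of Pᵐ
-- into three-term recurrences: the constant terms cₘ = [v⁰]Pᵐ satisfy
--   (m + 2) c_{m+2} = (2m + 3) S₁ c_{m+1} + (m + 1)(4S₂ − S₁²) cₘ,
-- and [u^ℓ]R^{-1/2} satisfies the same recurrence with S₁ = 2R₁, S₂ = R₂ + R₁², with the same initial
-- values. Hence [u^ℓ]R^{-1/2} = [v⁰]P^ℓ, and substituting this into the equations for R₁, R₂ shows that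
-- (2R₁, R₂ + R₁²) solves the system defining (S₁, S₂). That system has at most one solution, since its
-- right-hand sides carry a factor t; this gives (i). Part (ii) is the recursive definition of PᵏW
-- together with the symmetry P(S₂/v) = P(v). For (iii), (ii) expresses [v⁰]P²W and [v⁰]P³W through
-- wₙ = [vⁿ]W, and the resulting polynomial identity holds modulo t w₀ = S₁ and t S₂ w₁ = S₂ − t.

module Submission where

module Sums where

  open import Function using (_∘_)
  open import Data.Nat using (ℕ; zero; suc; _∸_; _<_; s≤s; z≤n; s≤s⁻¹)
  open import Data.Nat.Properties using (m∸[m∸n]≡n)
  open import Data.Rational using (ℚ; 0ℚ; _+_; _*_)
  open import Data.Rational.Properties
  open import Data.List using (List; []; _∷_; _++_; map; concatMap; upTo)
  open import Data.List.Properties using (map-upTo; map-applyUpTo)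
  open import Algebra.Bundles using (CommutativeMonoid)
  open import Algebra.Properties.CommutativeSemigroup
    (CommutativeMonoid.commutativeSemigroup +-0-commutativeMonoid) using (interchange)
  open import Relation.Binary.PropositionalEquality
  open import Defs using (sumℚ)

  private variable A B : Set

  ∑ : List A → (A → ℚ) → ℚ
  ∑ xs f = sumℚ (map f xs)

  ∑-cong : (xs : List A) {f g : A → ℚ} → (∀ x → f x ≡ g x) → ∑ xs f ≡ ∑ xs g
  ∑-cong []       eq = refl
  ∑-cong (x ∷ xs) eq = cong₂ _+_ (eq x) (∑-cong xs eq)

  ∑-zero : (xs : List A) → ∑ xs (λ _ → 0ℚ) ≡ 0ℚ
  ∑-zero []       = refl
  ∑-zero (x ∷ xs) = trans (+-identityˡ _) (∑-zero xs)

  ∑-vanishes : (xs : List A) {f : A → ℚ} → (∀ x → f x ≡ 0ℚ) → ∑ xs f ≡ 0ℚ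
  ∑-vanishes xs eq = trans (∑-cong xs eq) (∑-zero xs)

  ∑-zeroˡ : (xs : List A) (f : A → ℚ) → ∑ xs (λ x → 0ℚ * f x) ≡ 0ℚ
  ∑-zeroˡ xs f = ∑-vanishes xs (λ x → *-zeroˡ (f x))

  ∑-++ : (xs ys : List A) (f : A → ℚ) → ∑ (xs ++ ys) f ≡ ∑ xs f + ∑ ys f
  ∑-++ []       ys f = sym (+-identityˡ _)
  ∑-++ (x ∷ xs) ys f = trans (cong (f x +_) (∑-++ xs ys f)) (sym (+-assoc (f x) _ _))

  ∑-+ : (xs : List A) (f g : A → ℚ) → ∑ xs (λ x → f x + g x) ≡ ∑ xs f + ∑ xs g
  ∑-+ []       f g = refl
  ∑-+ (x ∷ xs) f g =
    trans (cong (f x + g x +_) (∑-+ xs f g)) (interchange (f x) (g x) _ _)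

  *-distribˡ-∑ : (c : ℚ) (xs : List A) (f : A → ℚ) → c * ∑ xs f ≡ ∑ xs (λ x → c * f x)
  *-distribˡ-∑ c []       f = *-zeroʳ c
  *-distribˡ-∑ c (x ∷ xs) f =
    trans (*-distribˡ-+ c (f x) _) (cong (c * f x +_) (*-distribˡ-∑ c xs f))

  *-distribʳ-∑ : (c : ℚ) (xs : List A) (f : A → ℚ) → ∑ xs f * c ≡ ∑ xs (λ x → f x * c)
  *-distribʳ-∑ c xs f =
    trans (*-comm _ c) (trans (*-distribˡ-∑ c xs f) (∑-cong xs (λ x → *-comm c (f x))))

  ∑-map : (g : A → B) (xs : List A) (f : B → ℚ) → ∑ (map g xs) f ≡ ∑ xs (f ∘ g)
  ∑-map g []       f = refl
  ∑-map g (x ∷ xs) f = cong (f (g x) +_) (∑-map g xs f)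

  ∑-concatMap : (g : A → List B) (xs : List A) (f : B → ℚ) →
                ∑ (concatMap g xs) f ≡ ∑ xs (λ x → ∑ (g x) f)
  ∑-concatMap g []       f = refl
  ∑-concatMap g (x ∷ xs) f =
    trans (∑-++ (g x) (concatMap g xs) f) (cong (∑ (g x) f +_) (∑-concatMap g xs f))

  ∑-comm : (xs : List A) (ys : List B) (f : A → B → ℚ) →
           ∑ xs (λ x → ∑ ys (f x)) ≡ ∑ ys (λ y → ∑ xs (λ x → f x y))
  ∑-comm []       ys f = sym (∑-zero ys)
  ∑-comm (x ∷ xs) ys f =
    trans (cong (∑ ys (f x) +_) (∑-comm xs ys f)) (sym (∑-+ ys (f x) _))

  ∑< : ℕ → (ℕ → ℚ) → ℚ
  ∑< n f = ∑ (upTo n) f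

  ∑<-suc : ∀ n (f : ℕ → ℚ) → ∑< (suc n) f ≡ f 0 + ∑< n (f ∘ suc)
  ∑<-suc n f = cong (f 0 +_) (trans (cong sumℚ (map-applyUpTo suc f n))
                                    (sym (cong sumℚ (map-upTo (f ∘ suc) n))))

  ∑<-cong : ∀ n {f g : ℕ → ℚ} → (∀ i → i < n → f i ≡ g i) → ∑< n f ≡ ∑< n g
  ∑<-cong zero    eq = refl
  ∑<-cong (suc n) {f} {g} eq = begin
    ∑< (suc n) f          ≡⟨ ∑<-suc n f ⟩
    f 0 + ∑< n (f ∘ suc)  ≡⟨ cong₂ _+_ (eq 0 (s≤s z≤n)) (∑<-cong n (λ i i<n → eq (suc i) (s≤s i<n))) ⟩
    g 0 + ∑< n (g ∘ suc)  ≡⟨ ∑<-suc n g ⟨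
    ∑< (suc n) g          ∎
    where open ≡-Reasoning

  ∑<-snoc : ∀ n (f : ℕ → ℚ) → ∑< (suc n) f ≡ ∑< n f + f n
  ∑<-snoc zero    f = trans (+-identityʳ (f 0)) (sym (+-identityˡ (f 0)))
  ∑<-snoc (suc n) f = begin
    ∑< (suc (suc n)) f                  ≡⟨ ∑<-suc (suc n) f ⟩
    f 0 + ∑< (suc n) (f ∘ suc)          ≡⟨ cong (f 0 +_) (∑<-snoc n (f ∘ suc)) ⟩
    f 0 + (∑< n (f ∘ suc) + f (suc n))  ≡⟨ +-assoc (f 0) _ _ ⟨
    (f 0 + ∑< n (f ∘ suc)) + f (suc n)  ≡⟨ cong (_+ f (suc n)) (∑<-suc n f) ⟨
    ∑< (suc n) f + f (suc n)            ∎
    where open ≡-Reasoning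

  ∑<-reverse : ∀ n (f : ℕ → ℚ) → ∑< (suc n) (λ i → f (n ∸ i)) ≡ ∑< (suc n) f
  ∑<-reverse zero    f = refl
  ∑<-reverse (suc n) f = begin
    ∑< (suc (suc n)) (λ i → f (suc n ∸ i))    ≡⟨ ∑<-suc (suc n) (λ i → f (suc n ∸ i)) ⟩
    f (suc n) + ∑< (suc n) (λ i → f (n ∸ i))  ≡⟨ cong (f (suc n) +_) (∑<-reverse n f) ⟩
    f (suc n) + ∑< (suc n) f                  ≡⟨ +-comm (f (suc n)) _ ⟩
    ∑< (suc n) f + f (suc n)                  ≡⟨ ∑<-snoc (suc n) f ⟨
    ∑< (suc (suc n)) f                        ∎
    where open ≡-Reasoning

  ∑<-reflect : ∀ n (f : ℕ → ℕ → ℚ) → ∑< (suc n) (λ i → f i (n ∸ i)) ≡ ∑< (suc n) (λ i → f (n ∸ i) i)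
  ∑<-reflect n f = begin
    ∑< (suc n) (λ i → f i (n ∸ i))              ≡⟨ ∑<-cong (suc n) (λ i i≤n → cong (λ k → f k (n ∸ i)) (sym (m∸[m∸n]≡n (s≤s⁻¹ i≤n)))) ⟩
    ∑< (suc n) (λ i → f (n ∸ (n ∸ i)) (n ∸ i))  ≡⟨ ∑<-reverse n (λ i → f (n ∸ i) i) ⟩
    ∑< (suc n) (λ i → f (n ∸ i) i)              ∎
    where open ≡-Reasoning

  -- Both sides sum F b c r over all b + c + r = n.
  ∑<-triangle : ∀ n (F : ℕ → ℕ → ℕ → ℚ) →
                ∑< (suc n) (λ a → ∑< (suc a) (λ b → F b (a ∸ b) (n ∸ a)))
                ≡ ∑< (suc n) (λ b → ∑< (suc (n ∸ b)) (λ c → F b c (n ∸ b ∸ c)))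
  ∑<-triangle zero    F = refl
  ∑<-triangle (suc n) F = begin
    ∑< (suc (suc n)) (λ a → ∑< (suc a) (λ b → F b (a ∸ b) (suc n ∸ a)))
      ≡⟨ ∑<-suc (suc n) (λ a → ∑< (suc a) (λ b → F b (a ∸ b) (suc n ∸ a))) ⟩
    (F 0 0 (suc n) + 0ℚ) + ∑< (suc n) (λ a → ∑< (suc (suc a)) (λ b → F b (suc a ∸ b) (n ∸ a)))
      ≡⟨ cong₂ _+_ (+-identityʳ (F 0 0 (suc n))) (∑<-cong (suc n) (λ a _ → ∑<-suc (suc a) (λ b → F b (suc a ∸ b) (n ∸ a)))) ⟩
    F 0 0 (suc n) + ∑< (suc n) (λ a → F 0 (suc a) (n ∸ a) + ∑< (suc a) (λ b → F (suc b) (a ∸ b) (n ∸ a)))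
      ≡⟨ cong (F 0 0 (suc n) +_) (∑-+ (upTo (suc n)) (λ a → F 0 (suc a) (n ∸ a))
                                              (λ a → ∑< (suc a) (λ b → F (suc b) (a ∸ b) (n ∸ a)))) ⟩
    F 0 0 (suc n) + (first + ∑< (suc n) (λ a → ∑< (suc a) (λ b → F (suc b) (a ∸ b) (n ∸ a))))
      ≡⟨ cong (λ s → F 0 0 (suc n) + (first + s)) (∑<-triangle n (F ∘ suc)) ⟩
    F 0 0 (suc n) + (first + rest)
      ≡⟨ +-assoc (F 0 0 (suc n)) first rest ⟨
    (F 0 0 (suc n) + first) + rest
      ≡⟨ cong (_+ rest) (∑<-suc (suc n) (λ c → F 0 c (suc n ∸ c))) ⟨
    ∑< (suc (suc n)) (λ c → F 0 c (suc n ∸ c)) + rest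
      ≡⟨ ∑<-suc (suc n) (λ b → ∑< (suc (suc n ∸ b)) (λ c → F b c (suc n ∸ b ∸ c))) ⟨
    ∑< (suc (suc n)) (λ b → ∑< (suc (suc n ∸ b)) (λ c → F b c (suc n ∸ b ∸ c))) ∎
    where
    open ≡-Reasoning
    first rest : ℚ
    first = ∑< (suc n) (λ a → F 0 (suc a) (n ∸ a))
    rest  = ∑< (suc n) (λ b → ∑< (suc (n ∸ b)) (λ c → F (suc b) c (n ∸ b ∸ c)))

module Monomials where

  open import Data.Nat using (ℕ; zero; suc; _∸_)
  open import Data.Nat.Properties using (suc-injective)
  open import Data.Bool using (Bool; true; false; _∧_)
  open import Data.Bool.Properties using (∧-comm)
  open import Data.List using (List; []; _∷_; _++_; [_]; reverse; replicate; zipWith; length)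
  open import Data.List.Properties using (reverse-++; reverse-involutive; unfold-reverse; ++-identityʳ; ++-assoc)
  open import Data.Maybe using (just; nothing)
  open import Data.Product using (∃; _,_)
  open import Relation.Binary.PropositionalEquality hiding ([_])
  open import Defs

  allZero : List ℕ → Bool
  allZero []          = true
  allZero (zero ∷ r)  = allZero r
  allZero (suc _ ∷ _) = false

  allZero-++ : ∀ xs ys → allZero (xs ++ ys) ≡ allZero xs ∧ allZero ys
  allZero-++ []           ys = refl
  allZero-++ (zero ∷ xs)  ys = allZero-++ xs ys
  allZero-++ (suc x ∷ xs) ys = refl

  allZero-reverse : ∀ xs → allZero (reverse xs) ≡ allZero xs
  allZero-reverse []       = refl
  allZero-reverse (x ∷ xs) = begin
    allZero (reverse (x ∷ xs))          ≡⟨ cong allZero (unfold-reverse x xs) ⟩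
    allZero (reverse xs ++ [ x ])       ≡⟨ allZero-++ (reverse xs) [ x ] ⟩
    allZero (reverse xs) ∧ allZero [ x ] ≡⟨ cong (_∧ allZero [ x ]) (allZero-reverse xs) ⟩
    allZero xs ∧ allZero [ x ]          ≡⟨ ∧-comm (allZero xs) _ ⟩
    allZero [ x ] ∧ allZero xs          ≡⟨ allZero-++ [ x ] xs ⟨
    allZero (x ∷ xs)                    ∎
    where open ≡-Reasoning

  normRev-allZero-++ : ∀ ys r → allZero ys ≡ true → normRev (ys ++ r) ≡ normRev r
  normRev-allZero-++ []         r _  = refl
  normRev-allZero-++ (zero ∷ ys) r h = normRev-allZero-++ ys r h

  fromList-allZero : ∀ d → allZero d ≡ true → fromList d ≡ nothing
  fromList-allZero d h =
    trans (cong normRev (sym (++-identityʳ (reverse d))))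
          (normRev-allZero-++ (reverse d) [] (trans (allZero-reverse d) h))

  fromList-notAllZero : ∀ d → allZero d ≡ false → ∃ λ q → fromList d ≡ just q
  fromList-notAllZero d h = go (reverse d) (trans (allZero-reverse d) h)
    where
    go : ∀ r → allZero r ≡ false → ∃ λ q → normRev r ≡ just q
    go (zero ∷ r)  h = go r h
    go (suc k ∷ r) h = _ , refl

  fromList-toList : ∀ m → fromList (toList m) ≡ m
  fromList-toList nothing        = refl
  fromList-toList (just (p , k)) = begin
    normRev (reverse (p ++ [ suc k ])) ≡⟨ cong normRev (reverse-++ p [ suc k ]) ⟩
    normRev (suc k ∷ reverse p)        ≡⟨ cong (λ q → just (q , k)) (reverse-involutive p) ⟩
    just (p , k)                       ∎
    where open ≡-Reasoning

  zeros : ℕ → List ℕ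
  zeros k = replicate k 0

  allZero-zeros : ∀ k → allZero (zeros k) ≡ true
  allZero-zeros zero    = refl
  allZero-zeros (suc k) = allZero-zeros k

  zeros-snoc : ∀ k → zeros k ++ [ 0 ] ≡ zeros (suc k)
  zeros-snoc zero    = refl
  zeros-snoc (suc k) = cong (0 ∷_) (zeros-snoc k)

  fromList-++-zeros : ∀ e k → fromList (e ++ zeros k) ≡ fromList e
  fromList-++-zeros e k = begin
    normRev (reverse (e ++ zeros k))             ≡⟨ cong normRev (reverse-++ e (zeros k)) ⟩
    normRev (reverse (zeros k) ++ reverse e)     ≡⟨ normRev-allZero-++ (reverse (zeros k)) (reverse e) allZero-rev-zeros ⟩
    normRev (reverse e)                          ∎
    where
    open ≡-Reasoning
    allZero-rev-zeros : allZero (reverse (zeros k)) ≡ true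
    allZero-rev-zeros = trans (allZero-reverse (zeros k)) (allZero-zeros k)

  reverse-normRev : ∀ r → ∃ λ k → reverse r ≡ toList (normRev r) ++ zeros k
  reverse-normRev []          = 0 , refl
  reverse-normRev (zero ∷ r)  with reverse-normRev r
  ... | k , eq = suc k , (begin
    reverse (0 ∷ r)                          ≡⟨ unfold-reverse 0 r ⟩
    reverse r ++ [ 0 ]                       ≡⟨ cong (_++ [ 0 ]) eq ⟩
    (toList (normRev r) ++ zeros k) ++ [ 0 ] ≡⟨ ++-assoc (toList (normRev r)) (zeros k) [ 0 ] ⟩
    toList (normRev r) ++ (zeros k ++ [ 0 ]) ≡⟨ cong (toList (normRev r) ++_) (zeros-snoc k) ⟩
    toList (normRev r) ++ zeros (suc k)      ∎)
    where open ≡-Reasoning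
  reverse-normRev (suc j ∷ r) = 0 , trans (unfold-reverse (suc j) r) (sym (++-identityʳ _))

  toList-fromList : ∀ e → ∃ λ k → e ≡ toList (fromList e) ++ zeros k
  toList-fromList e with reverse-normRev (reverse e)
  ... | k , eq = k , trans (sym (reverse-involutive e)) eq

  infixl 6 _−̇_
  _−̇_ : List ℕ → List ℕ → List ℕ
  _−̇_ = zipWith _∸_

  −̇-++ : ∀ xs ys us vs → length xs ≡ length ys → (xs ++ us) −̇ (ys ++ vs) ≡ (xs −̇ ys) ++ (us −̇ vs)
  −̇-++ []       []       us vs _  = refl
  −̇-++ (x ∷ xs) (y ∷ ys) us vs eq = cong (x ∸ y ∷_) (−̇-++ xs ys us vs (suc-injective eq))

  zeros-−̇-zeros : ∀ k → zeros k −̇ zeros k ≡ zeros k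
  zeros-−̇-zeros zero    = refl
  zeros-−̇-zeros (suc k) = cong (0 ∷_) (zeros-−̇-zeros k)

  −̇-zeros : ∀ e → e −̇ zeros (length e) ≡ e
  −̇-zeros []      = refl
  −̇-zeros (x ∷ e) = cong (x ∷_) (−̇-zeros e)

module DivisorSums where

  open import Data.Nat using (ℕ; zero; suc; _∸_)
  open import Data.Rational using (ℚ; 0ℚ; _+_)
  open import Data.Rational.Properties using (+-identityʳ)
  open import Data.List using (List; []; _∷_; _++_; map; upTo; length)
  open import Relation.Binary.PropositionalEquality
  open import Defs using (divs)
  open Sums
  open Monomials

  ∑div : List ℕ → (List ℕ → ℚ) → ℚ
  ∑div e f = ∑ (divs e) f

  ∑div-[] : ∀ f → ∑div [] f ≡ f []
  ∑div-[] f = +-identityʳ (f [])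

  ∑div-∷ : ∀ x e f → ∑div (x ∷ e) f ≡ ∑< (suc x) (λ a → ∑div e (λ d → f (a ∷ d)))
  ∑div-∷ x e f = trans (∑-concatMap (λ d → map (d ∷_) (divs e)) (upTo (suc x)) f)
                       (∑-cong (upTo (suc x)) (λ a → ∑-map (a ∷_) (divs e) f))

  ∑div-cong : ∀ e {f g} → (∀ d → f d ≡ g d) → ∑div e f ≡ ∑div e g
  ∑div-cong e = ∑-cong (divs e)

  ∑div-cong-length : ∀ e {f g} → (∀ d → length d ≡ length e → f d ≡ g d) → ∑div e f ≡ ∑div e g
  ∑div-cong-length []      eq = cong (_+ 0ℚ) (eq [] refl)
  ∑div-cong-length (x ∷ e) {f} {g} eq = begin
    ∑div (x ∷ e) f                              ≡⟨ ∑div-∷ x e f ⟩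
    ∑< (suc x) (λ a → ∑div e (λ d → f (a ∷ d))) ≡⟨ ∑-cong (upTo (suc x)) (λ a → ∑div-cong-length e (λ d l → eq (a ∷ d) (cong suc l))) ⟩
    ∑< (suc x) (λ a → ∑div e (λ d → g (a ∷ d))) ≡⟨ ∑div-∷ x e g ⟨
    ∑div (x ∷ e) g                              ∎
    where open ≡-Reasoning

  ∑div-∑<-comm : ∀ e n (f : List ℕ → ℕ → ℚ) → ∑div e (λ d → ∑< n (f d)) ≡ ∑< n (λ i → ∑div e (λ d → f d i))
  ∑div-∑<-comm e n f = ∑-comm (divs e) (upTo n) f

  ∑div-reflect : ∀ e (f : List ℕ → List ℕ → ℚ) → ∑div e (λ d → f d (e −̇ d)) ≡ ∑div e (λ d → f (e −̇ d) d)
  ∑div-reflect []      f = refl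
  ∑div-reflect (x ∷ e) f = begin
    ∑div (x ∷ e) (λ d → f d ((x ∷ e) −̇ d))
      ≡⟨ ∑div-∷ x e _ ⟩
    ∑< (suc x) (λ a → ∑div e (λ d → f (a ∷ d) ((x ∸ a) ∷ (e −̇ d))))
      ≡⟨ ∑-cong (upTo (suc x)) (λ a → ∑div-reflect e (λ p q → f (a ∷ p) ((x ∸ a) ∷ q))) ⟩
    ∑< (suc x) (λ a → g a (x ∸ a))
      ≡⟨ ∑<-reflect x g ⟩
    ∑< (suc x) (λ a → g (x ∸ a) a)
      ≡⟨ ∑div-∷ x e _ ⟨
    ∑div (x ∷ e) (λ d → f ((x ∷ e) −̇ d) d) ∎
    where
    open ≡-Reasoning
    g : ℕ → ℕ → ℚ
    g a b = ∑div e (λ d → f (a ∷ (e −̇ d)) (b ∷ d))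

  -- Both sides sum F d₁ d₂ d₃ over all factorisations d₁ + d₂ + d₃ = e.
  ∑div-triangle : ∀ e (F : List ℕ → List ℕ → List ℕ → ℚ) →
                  ∑div e (λ d → ∑div d (λ d' → F d' (d −̇ d') (e −̇ d)))
                  ≡ ∑div e (λ d' → ∑div (e −̇ d') (λ d'' → F d' d'' ((e −̇ d') −̇ d'')))
  ∑div-triangle []      F = refl
  ∑div-triangle (x ∷ e) F = begin
    ∑div (x ∷ e) (λ d → ∑div d (λ d' → F d' (d −̇ d') ((x ∷ e) −̇ d)))
      ≡⟨ ∑div-∷ x e _ ⟩
    ∑< (suc x) (λ a → ∑div e (λ p → ∑div (a ∷ p) (λ d' → F d' ((a ∷ p) −̇ d') ((x ∸ a) ∷ (e −̇ p)))))
      ≡⟨ ∑-cong (upTo (suc x)) (λ a → ∑div-cong e (λ p → ∑div-∷ a p _)) ⟩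
    ∑< (suc x) (λ a → ∑div e (λ p → ∑< (suc a) (λ b → ∑div p (λ q → F (b ∷ q) ((a ∸ b) ∷ (p −̇ q)) ((x ∸ a) ∷ (e −̇ p))))))
      ≡⟨ ∑-cong (upTo (suc x)) (λ a → ∑div-∑<-comm e (suc a) _) ⟩
    ∑< (suc x) (λ a → ∑< (suc a) (λ b → ∑div e (λ p → ∑div p (λ q → F (b ∷ q) ((a ∸ b) ∷ (p −̇ q)) ((x ∸ a) ∷ (e −̇ p))))))
      ≡⟨ ∑-cong (upTo (suc x)) (λ a → ∑-cong (upTo (suc a)) (λ b →
           ∑div-triangle e (λ p q r → F (b ∷ p) ((a ∸ b) ∷ q) ((x ∸ a) ∷ r)))) ⟩
    ∑< (suc x) (λ a → ∑< (suc a) (λ b → G b (a ∸ b) (x ∸ a)))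
      ≡⟨ ∑<-triangle x G ⟩
    ∑< (suc x) (λ b → ∑< (suc (x ∸ b)) (λ c → G b c (x ∸ b ∸ c)))
      ≡⟨ ∑-cong (upTo (suc x)) (λ b → sym (∑div-∑<-comm e (suc (x ∸ b)) _)) ⟩
    ∑< (suc x) (λ b → ∑div e (λ p → ∑< (suc (x ∸ b)) (λ c →
                        ∑div (e −̇ p) (λ q → F (b ∷ p) (c ∷ q) ((x ∸ b ∸ c) ∷ ((e −̇ p) −̇ q))))))
      ≡⟨ ∑-cong (upTo (suc x)) (λ b → ∑div-cong e (λ p → sym (∑div-∷ (x ∸ b) (e −̇ p) _))) ⟩
    ∑< (suc x) (λ b → ∑div e (λ p → ∑div ((x ∸ b) ∷ (e −̇ p)) (λ d'' → F (b ∷ p) d'' (((x ∸ b) ∷ (e −̇ p)) −̇ d''))))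
      ≡⟨ ∑div-∷ x e _ ⟨
    ∑div (x ∷ e) (λ d' → ∑div ((x ∷ e) −̇ d') (λ d'' → F d' d'' (((x ∷ e) −̇ d') −̇ d''))) ∎
    where
    open ≡-Reasoning
    G : ℕ → ℕ → ℕ → ℚ
    G b c r = ∑div e (λ p → ∑div (e −̇ p) (λ q → F (b ∷ p) (c ∷ q) (r ∷ ((e −̇ p) −̇ q))))

  ∑div-zeros : ∀ k f → ∑div (zeros k) f ≡ f (zeros k)
  ∑div-zeros zero    f = ∑div-[] f
  ∑div-zeros (suc k) f = trans (∑div-∷ 0 (zeros k) f) (trans (+-identityʳ _) (∑div-zeros k (λ d → f (0 ∷ d))))

  ∑div-++-zeros : ∀ e k f → ∑div (e ++ zeros k) f ≡ ∑div e (λ d → f (d ++ zeros k))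
  ∑div-++-zeros []      k f = trans (∑div-zeros k f) (sym (∑div-[] (λ d → f (d ++ zeros k))))
  ∑div-++-zeros (x ∷ e) k f = begin
    ∑div (x ∷ e ++ zeros k) f                                 ≡⟨ ∑div-∷ x (e ++ zeros k) f ⟩
    ∑< (suc x) (λ a → ∑div (e ++ zeros k) (λ d → f (a ∷ d)))  ≡⟨ ∑-cong (upTo (suc x)) (λ a → ∑div-++-zeros e k (λ d → f (a ∷ d))) ⟩
    ∑< (suc x) (λ a → ∑div e (λ d → f (a ∷ d ++ zeros k)))    ≡⟨ ∑div-∷ x e (λ d → f (d ++ zeros k)) ⟨
    ∑div (x ∷ e) (λ d → f (d ++ zeros k))                     ∎
    where open ≡-Reasoning

module CauchyProduct where

  open import Function using (id)
  open import Data.Nat using (ℕ; suc; _∸_)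
  open import Data.Rational using (ℚ; _*_)
  open import Data.Rational.Properties using (*-comm; *-assoc)
  open import Data.List using (List; _++_; map; concatMap; upTo; length)
  open import Data.List.Properties using (map-id)
  open import Data.Product using (_,_)
  open import Relation.Binary.PropositionalEquality
  open import Defs
  open Sums
  open Monomials
  open DivisorSums

  -- [tⁿ zᵉ]A for an exponent list e that need not be canonical (it may end in zeros).
  coef : Ser → ℕ → List ℕ → ℚ
  coef A n e = A n (fromList e)

  conv : Ser → Ser → ℕ → List ℕ → ℚ
  conv A B n e = ∑< (suc n) (λ n₁ → ∑div e (λ d → coef A n₁ d * coef B (n ∸ n₁) (e −̇ d)))

  sumℚ-concatMap : ∀ {A : Set} (g : A → List ℚ) xs → sumℚ (concatMap g xs) ≡ ∑ xs (λ x → sumℚ (g x))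
  sumℚ-concatMap g xs = begin
    sumℚ (concatMap g xs)               ≡⟨ cong sumℚ (map-id (concatMap g xs)) ⟨
    ∑ (concatMap g xs) id               ≡⟨ ∑-concatMap g xs id ⟩
    ∑ xs (λ x → ∑ (g x) id)             ≡⟨ ∑-cong xs (λ x → cong sumℚ (map-id (g x))) ⟩
    ∑ xs (λ x → sumℚ (g x))             ∎
    where open ≡-Reasoning

  ⊛-conv : ∀ A B n m → (A ⊛ B) n m ≡ conv A B n (toList m)
  ⊛-conv A B n m = sumℚ-concatMap
    (λ n₁ → map (λ d → A n₁ (fromList d) * B (n ∸ n₁) (fromList (toList m −̇ d))) (divs (toList m)))
    (upTo (suc n))

  conv-++-zeros : ∀ A B n e k → conv A B n (e ++ zeros k) ≡ conv A B n e
  conv-++-zeros A B n e k = ∑-cong (upTo (suc n)) λ n₁ → trans (∑div-++-zeros e k _) (∑div-cong-length e λ d l →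
    cong₂ _*_ (cong (A n₁) (fromList-++-zeros d k)) (cong (B (n ∸ n₁)) (complement d l)))
    where
    open ≡-Reasoning
    complement : ∀ d → length d ≡ length e → fromList ((e ++ zeros k) −̇ (d ++ zeros k)) ≡ fromList (e −̇ d)
    complement d l = begin
      fromList ((e ++ zeros k) −̇ (d ++ zeros k))  ≡⟨ cong fromList (−̇-++ e d (zeros k) (zeros k) (sym l)) ⟩
      fromList ((e −̇ d) ++ (zeros k −̇ zeros k))  ≡⟨ cong (λ z → fromList ((e −̇ d) ++ z)) (zeros-−̇-zeros k) ⟩
      fromList ((e −̇ d) ++ zeros k)              ≡⟨ fromList-++-zeros (e −̇ d) k ⟩
      fromList (e −̇ d)                           ∎

  coef-⊛ : ∀ A B n e → coef (A ⊛ B) n e ≡ conv A B n e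
  coef-⊛ A B n e with toList-fromList e
  ... | k , eq = trans (⊛-conv A B n (fromList e))
                       (trans (sym (conv-++-zeros A B n (toList (fromList e)) k)) (cong (conv A B n) (sym eq)))

  ≈-coef : ∀ {A B : Ser} → (∀ n e → coef A n e ≡ coef B n e) → A ≈ B
  ≈-coef {A} {B} h n m = begin
    A n m                      ≡⟨ cong (A n) (fromList-toList m) ⟨
    coef A n (toList m)        ≡⟨ h n (toList m) ⟩
    coef B n (toList m)        ≡⟨ cong (B n) (fromList-toList m) ⟩
    B n m                      ∎
    where open ≡-Reasoning

  conv-comm : ∀ A B n e → conv A B n e ≡ conv B A n e
  conv-comm A B n e = begin
    ∑< (suc n) (λ n₁ → ∑div e (λ d → coef A n₁ d * coef B (n ∸ n₁) (e −̇ d)))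
      ≡⟨ ∑-cong (upTo (suc n)) (λ n₁ → trans (∑div-reflect e (λ p q → coef A n₁ p * coef B (n ∸ n₁) q))
                                              (∑div-cong e (λ d → *-comm (coef A n₁ (e −̇ d)) _))) ⟩
    ∑< (suc n) (λ n₁ → g n₁ (n ∸ n₁))
      ≡⟨ ∑<-reflect n g ⟩
    ∑< (suc n) (λ n₁ → g (n ∸ n₁) n₁) ∎
    where
    open ≡-Reasoning
    g : ℕ → ℕ → ℚ
    g a b = ∑div e (λ d → coef B b d * coef A a (e −̇ d))

  ⊛-comm : ∀ A B → A ⊛ B ≈ B ⊛ A
  ⊛-comm A B = ≈-coef λ n e → trans (coef-⊛ A B n e) (trans (conv-comm A B n e) (sym (coef-⊛ B A n e)))

  module _ (A B C : Ser) (n : ℕ) (e : List ℕ) where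

    private
      term : ℕ → ℕ → ℕ → List ℕ → List ℕ → List ℕ → ℚ
      term a b c p q r = (coef A a p * coef B b q) * coef C c r

      -- The part of [t^(a+b+c)]·e of A B C coming from the degrees a, b, c of A, B, C.
      G : ℕ → ℕ → ℕ → ℚ
      G a b c = ∑div e (λ d′ → ∑div (e −̇ d′) (λ d″ → term a b c d′ d″ ((e −̇ d′) −̇ d″)))

    coef-⊛-assocˡ : coef ((A ⊛ B) ⊛ C) n e ≡ ∑< (suc n) (λ n₁ → ∑< (suc n₁) (λ n₂ → G n₂ (n₁ ∸ n₂) (n ∸ n₁)))
    coef-⊛-assocˡ = begin
      coef ((A ⊛ B) ⊛ C) n e
        ≡⟨ coef-⊛ (A ⊛ B) C n e ⟩
      ∑< (suc n) (λ n₁ → ∑div e (λ d → coef (A ⊛ B) n₁ d * coef C (n ∸ n₁) (e −̇ d)))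
        ≡⟨ ∑-cong (upTo (suc n)) (λ n₁ → ∑div-cong e (expand n₁)) ⟩
      ∑< (suc n) (λ n₁ → ∑div e (λ d → ∑< (suc n₁) (λ n₂ → F n₁ n₂ d)))
        ≡⟨ ∑-cong (upTo (suc n)) (λ n₁ → ∑div-∑<-comm e (suc n₁) (λ d n₂ → F n₁ n₂ d)) ⟩
      ∑< (suc n) (λ n₁ → ∑< (suc n₁) (λ n₂ → ∑div e (F n₁ n₂)))
        ≡⟨ ∑-cong (upTo (suc n)) (λ n₁ → ∑-cong (upTo (suc n₁)) (λ n₂ → ∑div-triangle e (term n₂ (n₁ ∸ n₂) (n ∸ n₁)))) ⟩
      ∑< (suc n) (λ n₁ → ∑< (suc n₁) (λ n₂ → G n₂ (n₁ ∸ n₂) (n ∸ n₁))) ∎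
      where
      open ≡-Reasoning
      F : ℕ → ℕ → List ℕ → ℚ
      F n₁ n₂ d = ∑div d (λ d′ → term n₂ (n₁ ∸ n₂) (n ∸ n₁) d′ (d −̇ d′) (e −̇ d))
      expand : ∀ n₁ d → coef (A ⊛ B) n₁ d * coef C (n ∸ n₁) (e −̇ d) ≡ ∑< (suc n₁) (λ n₂ → F n₁ n₂ d)
      expand n₁ d = begin
        coef (A ⊛ B) n₁ d * c
          ≡⟨ cong (_* c) (coef-⊛ A B n₁ d) ⟩
        ∑< (suc n₁) ab * c
          ≡⟨ *-distribʳ-∑ c (upTo (suc n₁)) ab ⟩
        ∑< (suc n₁) (λ n₂ → ab n₂ * c)
          ≡⟨ ∑-cong (upTo (suc n₁)) (λ n₂ → *-distribʳ-∑ c (divs d) (λ d′ → coef A n₂ d′ * coef B (n₁ ∸ n₂) (d −̇ d′))) ⟩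
        ∑< (suc n₁) (λ n₂ → F n₁ n₂ d) ∎
        where
        c = coef C (n ∸ n₁) (e −̇ d)
        ab : ℕ → ℚ
        ab n₂ = ∑div d (λ d′ → coef A n₂ d′ * coef B (n₁ ∸ n₂) (d −̇ d′))

    coef-⊛-assocʳ : coef (A ⊛ (B ⊛ C)) n e ≡ ∑< (suc n) (λ n₂ → ∑< (suc (n ∸ n₂)) (λ n₃ → G n₂ n₃ (n ∸ n₂ ∸ n₃)))
    coef-⊛-assocʳ = begin
      coef (A ⊛ (B ⊛ C)) n e
        ≡⟨ coef-⊛ A (B ⊛ C) n e ⟩
      ∑< (suc n) (λ n₂ → ∑div e (λ d′ → coef A n₂ d′ * coef (B ⊛ C) (n ∸ n₂) (e −̇ d′)))
        ≡⟨ ∑-cong (upTo (suc n)) (λ n₂ → ∑div-cong e (expand n₂)) ⟩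
      ∑< (suc n) (λ n₂ → ∑div e (λ d′ → ∑< (suc (n ∸ n₂)) (λ n₃ → F n₂ n₃ d′)))
        ≡⟨ ∑-cong (upTo (suc n)) (λ n₂ → ∑div-∑<-comm e (suc (n ∸ n₂)) (λ d′ n₃ → F n₂ n₃ d′)) ⟩
      ∑< (suc n) (λ n₂ → ∑< (suc (n ∸ n₂)) (λ n₃ → G n₂ n₃ (n ∸ n₂ ∸ n₃))) ∎
      where
      open ≡-Reasoning
      F : ℕ → ℕ → List ℕ → ℚ
      F n₂ n₃ d′ = ∑div (e −̇ d′) (λ d″ → term n₂ n₃ (n ∸ n₂ ∸ n₃) d′ d″ ((e −̇ d′) −̇ d″))
      expand : ∀ n₂ d′ → coef A n₂ d′ * coef (B ⊛ C) (n ∸ n₂) (e −̇ d′) ≡ ∑< (suc (n ∸ n₂)) (λ n₃ → F n₂ n₃ d′)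
      expand n₂ d′ = begin
        a * coef (B ⊛ C) m f
          ≡⟨ cong (a *_) (coef-⊛ B C m f) ⟩
        a * ∑< (suc m) bc
          ≡⟨ *-distribˡ-∑ a (upTo (suc m)) bc ⟩
        ∑< (suc m) (λ n₃ → a * bc n₃)
          ≡⟨ ∑-cong (upTo (suc m)) (λ n₃ → trans (*-distribˡ-∑ a (divs f) (λ d″ → coef B n₃ d″ * coef C (m ∸ n₃) (f −̇ d″)))
                                                 (∑div-cong f (λ d″ → sym (*-assoc a _ _)))) ⟩
        ∑< (suc m) (λ n₃ → F n₂ n₃ d′) ∎
        where
        a = coef A n₂ d′
        m = n ∸ n₂
        f = e −̇ d′
        bc : ℕ → ℚ
        bc n₃ = ∑div f (λ d″ → coef B n₃ d″ * coef C (m ∸ n₃) (f −̇ d″))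

    coef-⊛-assoc : coef ((A ⊛ B) ⊛ C) n e ≡ coef (A ⊛ (B ⊛ C)) n e
    coef-⊛-assoc = trans coef-⊛-assocˡ (trans (∑<-triangle n G) (sym coef-⊛-assocʳ))

  ⊛-assoc : ∀ A B C → (A ⊛ B) ⊛ C ≈ A ⊛ (B ⊛ C)
  ⊛-assoc A B C = ≈-coef (coef-⊛-assoc A B C)

module SeriesRing where

  open import Data.Nat using (ℕ; zero; suc; _∸_)
  open import Data.Bool using (true; false; if_then_else_)
  open import Data.Rational using (ℚ; 0ℚ; 1ℚ; _+_; _*_; -_; _-_)
  open import Data.Rational.Properties as ℚ using ()
  open import Data.List using (List; []; _∷_; upTo; length)
  open import Data.Maybe using (Maybe; just; nothing)
  open import Data.Product using (_,_)
  open import Relation.Binary.PropositionalEquality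
  open import Relation.Binary.Structures using (IsEquivalence)
  open import Relation.Binary.Bundles using (Setoid)
  open import Relation.Nullary using (yes; no)
  open import Algebra.Bundles using (CommutativeRing)
  open import Algebra.Solver.Ring.AlmostCommutativeRing
    using (AlmostCommutativeRing; fromCommutativeRing; _-Raw-AlmostCommutative⟶_)
  import Algebra.Solver.Ring as RingSolver
  import Relation.Binary.Reasoning.Setoid as SetoidReasoning
  open import Defs
  open Sums
  open Monomials
  open DivisorSums
  open CauchyProduct

  private
    δ : List ℕ → ℚ → ℚ
    δ d c = if allZero d then c else 0ℚ

    coef-zero-nothing : (A : Ser) → (∀ q → A 0 (just q) ≡ 0ℚ) → ∀ d → coef A 0 d ≡ δ d (A 0 nothing)
    coef-zero-nothing A h d with allZero d in eq
    ... | true  = cong (A 0) (fromList-allZero d eq)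
    ... | false with fromList-notAllZero d eq
    ...   | q , e = trans (cong (A 0) e) (h q)

    ∑div-δ : ∀ e c (g : List ℕ → ℚ) → ∑div e (λ d → δ d c * g d) ≡ c * g (zeros (length e))
    ∑div-δ []      c g = ℚ.+-identityʳ (c * g [])
    ∑div-δ (x ∷ e) c g = begin
      ∑div (x ∷ e) (λ d → δ d c * g d)
        ≡⟨ ∑div-∷ x e (λ d → δ d c * g d) ⟩
      ∑< (suc x) (λ a → ∑div e (λ d → δ (a ∷ d) c * g (a ∷ d)))
        ≡⟨ ∑<-suc x (λ a → ∑div e (λ d → δ (a ∷ d) c * g (a ∷ d))) ⟩
      ∑div e (λ d → δ d c * g (0 ∷ d)) + ∑< x (λ a → ∑div e (λ d → 0ℚ * g (suc a ∷ d)))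
        ≡⟨ cong₂ _+_ (∑div-δ e c (λ d → g (0 ∷ d)))
                     (∑-vanishes (upTo x) (λ a → ∑-zeroˡ (divs e) (λ d → g (suc a ∷ d)))) ⟩
      c * g (zeros (suc (length e))) + 0ℚ
        ≡⟨ ℚ.+-identityʳ _ ⟩
      c * g (zeros (suc (length e))) ∎
      where open ≡-Reasoning

  conv-scalar : ∀ (A B : Ser) n e → (∀ q → A 0 (just q) ≡ 0ℚ) → (∀ j m → A (suc j) m ≡ 0ℚ) →
                conv A B n e ≡ A 0 nothing * coef B n e
  conv-scalar A B n e h₀ hₛ = begin
    conv A B n e
      ≡⟨ ∑<-suc n (λ j → ∑div e (λ d → coef A j d * coef B (n ∸ j) (e −̇ d))) ⟩
    ∑div e (λ d → coef A 0 d * coef B n (e −̇ d)) + ∑< n (λ j → ∑div e (λ d → coef A (suc j) d * coef B (n ∸ suc j) (e −̇ d)))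
      ≡⟨ cong₂ _+_ (trans (∑div-cong e (λ d → cong (_* coef B n (e −̇ d)) (coef-zero-nothing A h₀ d)))
                          (∑div-δ e c (λ d → coef B n (e −̇ d))))
                   (∑-vanishes (upTo n) (λ j → ∑-vanishes (divs e) (λ d →
                      trans (cong (_* coef B (n ∸ suc j) (e −̇ d)) (hₛ j (fromList d))) (ℚ.*-zeroˡ (coef B (n ∸ suc j) (e −̇ d)))))) ⟩
    c * coef B n (e −̇ zeros (length e)) + 0ℚ
      ≡⟨ trans (ℚ.+-identityʳ _) (cong (λ f → c * coef B n f) (−̇-zeros e)) ⟩
    c * coef B n e ∎
    where
    open ≡-Reasoning
    c = A 0 nothing

  cst-⊛ : ∀ c B → cst c ⊛ B ≈ c · B
  cst-⊛ c B = ≈-coef λ n e → trans (coef-⊛ (cst c) B n e) (conv-scalar (cst c) B n e (λ _ → refl) (λ _ _ → refl))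

  t⊛-coef-zero : ∀ B m → (tS ⊛ B) 0 m ≡ 0ℚ
  t⊛-coef-zero B m = trans (⊛-conv tS B 0 m)
    (trans (ℚ.+-identityʳ _) (∑-zeroˡ (divs (toList m)) (λ d → coef B 0 (toList m −̇ d))))

  t⊛-coef-suc : ∀ B n m → (tS ⊛ B) (suc n) m ≡ B n m
  t⊛-coef-suc B n m = begin
    (tS ⊛ B) (suc n) m
      ≡⟨ ⊛-conv tS B (suc n) m ⟩
    conv tS B (suc n) e
      ≡⟨ ∑<-suc (suc n) (λ j → ∑div e (λ d → coef tS j d * coef B (suc n ∸ j) (e −̇ d))) ⟩
    ∑div e (λ d → 0ℚ * coef B (suc n) (e −̇ d)) + conv shifted B n e
      ≡⟨ cong₂ _+_ (∑-zeroˡ (divs e) (λ d → coef B (suc n) (e −̇ d)))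
                   (conv-scalar shifted B n e (λ _ → refl) shifted-suc) ⟩
    0ℚ + 1ℚ * coef B n e
      ≡⟨ trans (ℚ.+-identityˡ _) (ℚ.*-identityˡ _) ⟩
    B n (fromList e)
      ≡⟨ cong (B n) (fromList-toList m) ⟩
    B n m ∎
    where
    open ≡-Reasoning
    e = toList m
    shifted : Ser
    shifted j = tS (suc j)
    shifted-suc : ∀ j m → shifted (suc j) m ≡ 0ℚ
    shifted-suc _ _ = refl

  ⊛-cong : ∀ {A A′ B B′} → A ≈ A′ → B ≈ B′ → A ⊛ B ≈ A′ ⊛ B′
  ⊛-cong {A} {A′} {B} {B′} eA eB n m = trans (⊛-conv A B n m) (trans
    (∑-cong (upTo (suc n)) (λ n₁ → ∑div-cong (toList m) (λ d → cong₂ _*_ (eA n₁ (fromList d)) (eB (n ∸ n₁) _))))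
    (sym (⊛-conv A′ B′ n m)))

  ⊛-distribʳ-⊕ : ∀ A B C → (A ⊕ B) ⊛ C ≈ A ⊛ C ⊕ B ⊛ C
  ⊛-distribʳ-⊕ A B C n m = begin
    ((A ⊕ B) ⊛ C) n m
      ≡⟨ ⊛-conv (A ⊕ B) C n m ⟩
    ∑< (suc n) (λ j → ∑div e (λ d → (coef A j d + coef B j d) * c j d))
      ≡⟨ ∑-cong (upTo (suc n)) (λ j → trans (∑div-cong e (λ d → ℚ.*-distribʳ-+ (c j d) (coef A j d) _))
                                            (∑-+ (divs e) (λ d → coef A j d * c j d) _)) ⟩
    ∑< (suc n) (λ j → ∑div e (λ d → coef A j d * c j d) + ∑div e (λ d → coef B j d * c j d))
      ≡⟨ ∑-+ (upTo (suc n)) (λ j → ∑div e (λ d → coef A j d * c j d)) _ ⟩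
    conv A C n e + conv B C n e
      ≡⟨ cong₂ _+_ (⊛-conv A C n m) (⊛-conv B C n m) ⟨
    (A ⊛ C ⊕ B ⊛ C) n m ∎
    where
    open ≡-Reasoning
    e = toList m
    c : ℕ → List ℕ → ℚ
    c j d = coef C (n ∸ j) (e −̇ d)

  -S_ : Ser → Ser
  (-S A) n m = - A n m

  -- Series equality wrapped in a record, so that both sides stay visible to unification.
  infix 4 _≋_
  record _≋_ (A B : Ser) : Set where
    constructor mk
    field un : A ≈ B
  open _≋_ public

  ≋-refl : ∀ {A} → A ≋ A
  ≋-refl = mk (λ _ _ → refl)

  same : ∀ A → A ≋ A
  same A = ≋-refl

  ≋-sym : ∀ {A B} → A ≋ B → B ≋ A
  ≋-sym e = mk (λ n m → sym (un e n m))

  ≋-trans : ∀ {A B C} → A ≋ B → B ≋ C → A ≋ C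
  ≋-trans e f = mk (λ n m → trans (un e n m) (un f n m))

  ≡⇒≋ : ∀ {A B} → A ≡ B → A ≋ B
  ≡⇒≋ refl = ≋-refl

  ≋-isEquivalence : IsEquivalence _≋_
  ≋-isEquivalence = record { refl = ≋-refl ; sym = ≋-sym ; trans = ≋-trans }

  ≋-setoid : Setoid _ _
  ≋-setoid = record { isEquivalence = ≋-isEquivalence }

  module ≋-Reasoning = SetoidReasoning ≋-setoid

  infixl 6 _⊕≋_ _⊖≋_
  infixl 7 _⊛≋_

  _⊕≋_ : ∀ {A A′ B B′} → A ≋ A′ → B ≋ B′ → A ⊕ B ≋ A′ ⊕ B′
  e ⊕≋ f = mk (λ n m → cong₂ _+_ (un e n m) (un f n m))

  _⊖≋_ : ∀ {A A′ B B′} → A ≋ A′ → B ≋ B′ → A ⊖ B ≋ A′ ⊖ B′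
  e ⊖≋ f = mk (λ n m → cong₂ _-_ (un e n m) (un f n m))

  _⊛≋_ : ∀ {A A′ B B′} → A ≋ A′ → B ≋ B′ → A ⊛ B ≋ A′ ⊛ B′
  e ⊛≋ f = mk (⊛-cong (un e) (un f))

  private
    cst-zero : ∀ n m → cst 0ℚ n m ≡ 0ℚ
    cst-zero zero    nothing  = refl
    cst-zero zero    (just _) = refl
    cst-zero (suc n) m        = refl

    1-⊛ : ∀ A → 1S ⊛ A ≋ A
    1-⊛ A = mk (λ n m → trans (cst-⊛ 1ℚ A n m) (ℚ.*-identityˡ _))

    ⊛-comm≋ : ∀ A B → A ⊛ B ≋ B ⊛ A
    ⊛-comm≋ A B = mk (⊛-comm A B)

    ⊛-distribʳ-⊕≋ : ∀ C A B → (A ⊕ B) ⊛ C ≋ A ⊛ C ⊕ B ⊛ C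
    ⊛-distribʳ-⊕≋ C A B = mk (⊛-distribʳ-⊕ A B C)

  seriesRing : CommutativeRing _ _
  seriesRing = record
    { Carrier = Ser ; _≈_ = _≋_ ; _+_ = _⊕_ ; _*_ = _⊛_ ; -_ = -S_ ; 0# = 0S ; 1# = 1S
    ; isCommutativeRing = record
      { isRing = record
        { +-isAbelianGroup = record
          { isGroup = record
            { isMonoid = record
              { isSemigroup = record
                { isMagma = record { isEquivalence = ≋-isEquivalence ; ∙-cong = _⊕≋_ }
                ; assoc = λ A B C → mk λ n m → ℚ.+-assoc (A n m) (B n m) (C n m) }
              ; identity = (λ A → mk λ n m → trans (cong (_+ A n m) (cst-zero n m)) (ℚ.+-identityˡ _))
                         , (λ A → mk λ n m → trans (cong (A n m +_) (cst-zero n m)) (ℚ.+-identityʳ _)) }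
            ; inverse = (λ A → mk λ n m → trans (ℚ.+-inverseˡ (A n m)) (sym (cst-zero n m)))
                      , (λ A → mk λ n m → trans (ℚ.+-inverseʳ (A n m)) (sym (cst-zero n m)))
            ; ⁻¹-cong = λ e → mk λ n m → cong -_ (un e n m) }
          ; comm = λ A B → mk λ n m → ℚ.+-comm (A n m) (B n m) }
        ; *-cong = _⊛≋_
        ; *-assoc = λ A B C → mk (⊛-assoc A B C)
        ; *-identity = 1-⊛ , (λ A → ≋-trans (⊛-comm≋ A 1S) (1-⊛ A))
        ; distrib = (λ A B C → ≋-trans (⊛-comm≋ A (B ⊕ C))
                                (≋-trans (⊛-distribʳ-⊕≋ A B C) (⊛-comm≋ B A ⊕≋ ⊛-comm≋ C A)))
                  , ⊛-distribʳ-⊕≋ }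
      ; *-comm = ⊛-comm≋ } }

  cst-homomorphism : CommutativeRing.rawRing ℚ.+-*-commutativeRing -Raw-AlmostCommutative⟶ fromCommutativeRing seriesRing
  cst-homomorphism = record
    { ⟦_⟧ = cst
    ; +-homo = λ c d → mk (+-homo c d)
    ; *-homo = λ c d → mk λ n m → trans (*-homo c d n m) (sym (cst-⊛ c (cst d) n m))
    ; -‿homo = λ c → mk (neg-homo c)
    ; 0-homo = ≋-refl
    ; 1-homo = ≋-refl }
    where
    +-homo : ∀ c d → cst (c + d) ≈ cst c ⊕ cst d
    +-homo c d zero    nothing  = refl
    +-homo c d zero    (just _) = refl
    +-homo c d (suc n) m        = refl
    *-homo : ∀ c d → cst (c * d) ≈ c · cst d
    *-homo c d zero    nothing  = refl
    *-homo c d zero    (just _) = sym (ℚ.*-zeroʳ c)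
    *-homo c d (suc n) m        = sym (ℚ.*-zeroʳ c)
    neg-homo : ∀ c → cst (- c) ≈ -S cst c
    neg-homo c zero    nothing  = refl
    neg-homo c zero    (just _) = refl
    neg-homo c (suc n) m        = refl

  private
    cst-≟ : ∀ c d → Maybe (cst c ≋ cst d)
    cst-≟ c d with c ℚ.≟ d
    ... | yes p = just (≡⇒≋ (cong cst p))
    ... | no _  = nothing

  module Solver = RingSolver (CommutativeRing.rawRing ℚ.+-*-commutativeRing)
                             (fromCommutativeRing seriesRing) cst-homomorphism cst-≟

  ·-as-⊛ : ∀ c A → c · A ≋ cst c ⊛ A
  ·-as-⊛ c A = mk (λ n m → sym (cst-⊛ c A n m))

module ZSums where

  open import Data.Nat using (ℕ; zero; suc; _∸_; s≤s⁻¹)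
  open import Data.Nat.Properties using (+-∸-assoc; n∸n≡0)
  open import Data.Rational using (ℚ; 0ℚ; _+_; _*_)
  open import Data.Rational.Properties using (+-identityˡ; +-identityʳ; *-zeroʳ; *-distribˡ-+)
  open import Data.List using (List; []; _∷_; _++_; upTo; length)
  open import Data.Maybe using (Maybe; just; nothing; maybe′)
  open import Data.Maybe.Properties using (maybe′-map)
  open import Data.Product using (_,_)
  open import Relation.Binary.PropositionalEquality
  open import Defs
  open Sums
  open Monomials
  open DivisorSums
  open CauchyProduct
  open SeriesRing using (_≋_; mk; un)

  ∑z : (ℕ → List ℕ → ℚ) → List ℕ → ℚ
  ∑z Y l = ∑< (length l) (λ i → maybe′ (Y i) 0ℚ (decAt i l))

  zTerms : (ℕ → Ser) → ℕ → ℕ → List ℕ → ℚ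
  zTerms X n i l = coef (X (suc i)) n l

  private
    head : (ℕ → List ℕ → ℚ) → ℕ → List ℕ → ℚ
    head Y zero    r = 0ℚ
    head Y (suc x) r = Y 0 (x ∷ r)

  ∑z-∷ : ∀ Y x l → ∑z Y (x ∷ l) ≡ head Y x l + ∑z (λ i l′ → Y (suc i) (x ∷ l′)) l
  ∑z-∷ Y x l = trans (∑<-suc (length l) (λ i → maybe′ (Y i) 0ℚ (decAt i (x ∷ l))))
    (cong₂ _+_ (first x) (∑-cong (upTo (length l)) (λ i → maybe′-map (Y (suc i)) 0ℚ (x ∷_) (decAt i l))))
    where
    first : ∀ x → maybe′ (Y 0) 0ℚ (decAt 0 (x ∷ l)) ≡ head Y x l
    first zero    = refl
    first (suc x) = refl

  ∑z-cong : ∀ l {Y Y′} → (∀ i l′ → Y i l′ ≡ Y′ i l′) → ∑z Y l ≡ ∑z Y′ l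
  ∑z-cong l {Y} {Y′} eq = ∑-cong (upTo (length l)) (λ i → go i (decAt i l))
    where
    go : ∀ i mb → maybe′ (Y i) 0ℚ mb ≡ maybe′ (Y′ i) 0ℚ mb
    go i nothing  = refl
    go i (just x) = eq i x

  ∑-∑z-comm : ∀ {A : Set} (xs : List A) l (Y : A → ℕ → List ℕ → ℚ) →
              ∑ xs (λ a → ∑z (Y a) l) ≡ ∑z (λ i l′ → ∑ xs (λ a → Y a i l′)) l
  ∑-∑z-comm xs l Y = trans (∑-comm xs (upTo (length l)) (λ a i → maybe′ (Y a i) 0ℚ (decAt i l)))
                           (∑-cong (upTo (length l)) (λ i → go i (decAt i l)))
    where
    go : ∀ i mb → ∑ xs (λ a → maybe′ (Y a i) 0ℚ mb) ≡ maybe′ (λ l′ → ∑ xs (λ a → Y a i l′)) 0ℚ mb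
    go i nothing  = ∑-zero xs
    go i (just x) = refl

  ∑z-zeros : ∀ k Y → ∑z Y (zeros k) ≡ 0ℚ
  ∑z-zeros zero    Y = refl
  ∑z-zeros (suc k) Y = trans (∑z-∷ Y 0 (zeros k)) (trans (+-identityˡ _) (∑z-zeros k (λ i l′ → Y (suc i) (0 ∷ l′))))

  ∑z-++-zeros : ∀ l k Y → (∀ i l′ → Y i (l′ ++ zeros k) ≡ Y i l′) → ∑z Y (l ++ zeros k) ≡ ∑z Y l
  ∑z-++-zeros []      k Y h = ∑z-zeros k Y
  ∑z-++-zeros (x ∷ l) k Y h = begin
    ∑z Y (x ∷ l ++ zeros k)                                   ≡⟨ ∑z-∷ Y x (l ++ zeros k) ⟩
    head Y x (l ++ zeros k) + ∑z Y′ (l ++ zeros k)            ≡⟨ cong₂ _+_ (head-zeros x)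
                                                                   (∑z-++-zeros l k Y′ (λ i l′ → h (suc i) (x ∷ l′))) ⟩
    head Y x l + ∑z Y′ l                                      ≡⟨ ∑z-∷ Y x l ⟨
    ∑z Y (x ∷ l)                                              ∎
    where
    open ≡-Reasoning
    Y′ : ℕ → List ℕ → ℚ
    Y′ i l′ = Y (suc i) (x ∷ l′)
    head-zeros : ∀ x → head Y x (l ++ zeros k) ≡ head Y x l
    head-zeros zero    = refl
    head-zeros (suc x) = h 0 (x ∷ l)

  coef-zSum : ∀ X n e → coef (zSum X) n e ≡ ∑z (zTerms X n) e
  coef-zSum X n e with toList-fromList e
  ... | k , eq = trans (sym (∑z-++-zeros (toList (fromList e)) k (zTerms X n)
                                         (λ i l′ → cong (X (suc i) n) (fromList-++-zeros l′ k))))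
                       (cong (∑z (zTerms X n)) (sym eq))

  private
    ∑div-head : ∀ x l (g : List ℕ → ℚ) (Y : ℕ → List ℕ → ℚ) →
                ∑< (suc x) (λ a → ∑div l (λ d → g (a ∷ d) * head Y (x ∸ a) (l −̇ d)))
                ≡ head (λ i l′ → ∑div l′ (λ d → g d * Y i (l′ −̇ d))) x l
    ∑div-head zero    l g Y = trans (+-identityʳ _) (∑-vanishes (divs l) (λ d → *-zeroʳ (g (0 ∷ d))))
    ∑div-head (suc x) l g Y = begin
      ∑< (suc (suc x)) (λ a → ∑div l (λ d → g (a ∷ d) * head Y (suc x ∸ a) (l −̇ d)))
        ≡⟨ ∑<-snoc (suc x) (λ a → ∑div l (λ d → g (a ∷ d) * head Y (suc x ∸ a) (l −̇ d))) ⟩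
      ∑< (suc x) (λ a → ∑div l (λ d → g (a ∷ d) * head Y (suc x ∸ a) (l −̇ d)))
        + ∑div l (λ d → g (suc x ∷ d) * head Y (x ∸ x) (l −̇ d))
        ≡⟨ cong₂ _+_ (∑<-cong (suc x) (λ a a≤x → cong (λ z → ∑div l (λ d → g (a ∷ d) * head Y z (l −̇ d)))
                                                         (+-∸-assoc 1 (s≤s⁻¹ a≤x))))
                     (∑-vanishes (divs l) (λ d → trans (cong (λ z → g (suc x ∷ d) * head Y z (l −̇ d)) (n∸n≡0 x))
                                                       (*-zeroʳ (g (suc x ∷ d))))) ⟩
      ∑< (suc x) (λ a → ∑div l (λ d → g (a ∷ d) * Y 0 ((x ∸ a) ∷ (l −̇ d)))) + 0ℚ
        ≡⟨ trans (+-identityʳ _) (sym (∑div-∷ x l (λ d → g d * Y 0 ((x ∷ l) −̇ d)))) ⟩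
      ∑div (x ∷ l) (λ d → g d * Y 0 ((x ∷ l) −̇ d)) ∎
      where open ≡-Reasoning

  ∑div-∑z : ∀ e (g : List ℕ → ℚ) (Y : ℕ → List ℕ → ℚ) →
            ∑div e (λ d → g d * ∑z Y (e −̇ d)) ≡ ∑z (λ i l → ∑div l (λ d → g d * Y i (l −̇ d))) e
  ∑div-∑z []      g Y = trans (∑div-[] (λ d → g d * ∑z Y ([] −̇ d))) (*-zeroʳ (g []))
  ∑div-∑z (x ∷ l) g Y = begin
    ∑div (x ∷ l) (λ d → g d * ∑z Y ((x ∷ l) −̇ d))
      ≡⟨ ∑div-∷ x l (λ d → g d * ∑z Y ((x ∷ l) −̇ d)) ⟩
    ∑< (suc x) (λ a → ∑div l (λ d → g (a ∷ d) * ∑z Y ((x ∸ a) ∷ (l −̇ d))))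
      ≡⟨ ∑-cong (upTo (suc x)) (λ a → trans (∑div-cong l (λ d → split a d)) (∑-+ (divs l) (H a) (T a))) ⟩
    ∑< (suc x) (λ a → ∑div l (H a) + ∑div l (T a))
      ≡⟨ ∑-+ (upTo (suc x)) (λ a → ∑div l (H a)) (λ a → ∑div l (T a)) ⟩
    ∑< (suc x) (λ a → ∑div l (H a)) + ∑< (suc x) (λ a → ∑div l (T a))
      ≡⟨ cong₂ _+_ (∑div-head x l g Y)
                   (trans (∑-cong (upTo (suc x)) (λ a → ∑div-∑z l (λ d → g (a ∷ d)) (λ i l′ → Y (suc i) ((x ∸ a) ∷ l′))))
                          (∑-∑z-comm (upTo (suc x)) l (λ a i l′ → ∑div l′ (λ d → g (a ∷ d) * Y (suc i) ((x ∸ a) ∷ (l′ −̇ d)))))) ⟩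
    head Y₂ x l + ∑z (λ i l′ → ∑< (suc x) (λ a → ∑div l′ (λ d → g (a ∷ d) * Y (suc i) ((x ∸ a) ∷ (l′ −̇ d))))) l
      ≡⟨ cong (head Y₂ x l +_) (∑z-cong l (λ i l′ → sym (∑div-∷ x l′ (λ d → g d * Y (suc i) ((x ∷ l′) −̇ d))))) ⟩
    head Y₂ x l + ∑z (λ i l′ → Y₂ (suc i) (x ∷ l′)) l
      ≡⟨ ∑z-∷ Y₂ x l ⟨
    ∑z Y₂ (x ∷ l) ∎
    where
    open ≡-Reasoning
    Y₂ : ℕ → List ℕ → ℚ
    Y₂ i l′ = ∑div l′ (λ d → g d * Y i (l′ −̇ d))
    H T : ℕ → List ℕ → ℚ
    H a d = g (a ∷ d) * head Y (x ∸ a) (l −̇ d)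
    T a d = g (a ∷ d) * ∑z (λ i l′ → Y (suc i) ((x ∸ a) ∷ l′)) (l −̇ d)
    split : ∀ a d → g (a ∷ d) * ∑z Y ((x ∸ a) ∷ (l −̇ d)) ≡ H a d + T a d
    split a d = trans (cong (g (a ∷ d) *_) (∑z-∷ Y (x ∸ a) (l −̇ d)))
                      (*-distribˡ-+ (g (a ∷ d)) (head Y (x ∸ a) (l −̇ d)) _)

  zSum-cong : ∀ (X Y : ℕ → Ser) → (∀ i → X (suc i) ≋ Y (suc i)) → zSum X ≋ zSum Y
  zSum-cong X Y eq = mk λ n m → ∑z-cong (toList m) (λ i l → un (eq i) n (fromList l))

  zSum-⊕ : ∀ X Y → zSum (λ i → X i ⊕ Y i) ≋ zSum X ⊕ zSum Y
  zSum-⊕ X Y = mk λ n m → trans (∑-cong (upTo (length (toList m))) (λ i → go n i (decAt i (toList m))))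
                                 (∑-+ (upTo (length (toList m))) _ _)
    where
    go : ∀ n i mb → maybe′ (zTerms (λ i → X i ⊕ Y i) n i) 0ℚ mb
                    ≡ maybe′ (zTerms X n i) 0ℚ mb + maybe′ (zTerms Y n i) 0ℚ mb
    go n i nothing  = refl
    go n i (just _) = refl

  ⊛-zSum : ∀ A X → A ⊛ zSum X ≋ zSum (λ i → A ⊛ X i)
  ⊛-zSum A X = mk (≈-coef λ n e → begin
    coef (A ⊛ zSum X) n e
      ≡⟨ coef-⊛ A (zSum X) n e ⟩
    ∑< (suc n) (λ n₁ → ∑div e (λ d → coef A n₁ d * coef (zSum X) (n ∸ n₁) (e −̇ d)))
      ≡⟨ ∑-cong (upTo (suc n)) (λ n₁ → trans (∑div-cong e (λ d → cong (coef A n₁ d *_) (coef-zSum X (n ∸ n₁) (e −̇ d))))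
                                             (∑div-∑z e (coef A n₁) (zTerms X (n ∸ n₁)))) ⟩
    ∑< (suc n) (λ n₁ → ∑z (λ i l → ∑div l (λ d → coef A n₁ d * zTerms X (n ∸ n₁) i (l −̇ d))) e)
      ≡⟨ ∑-∑z-comm (upTo (suc n)) e (λ n₁ i l → ∑div l (λ d → coef A n₁ d * zTerms X (n ∸ n₁) i (l −̇ d))) ⟩
    ∑z (λ i l → conv A (X (suc i)) n l) e
      ≡⟨ ∑z-cong e (λ i l → sym (coef-⊛ A (X (suc i)) n l)) ⟩
    ∑z (zTerms (λ i → A ⊛ X i) n) e
      ≡⟨ coef-zSum (λ i → A ⊛ X i) n e ⟨
    coef (zSum (λ i → A ⊛ X i)) n e ∎)
    where open ≡-Reasoning

module Uniqueness where

  open import Data.Nat using (ℕ; zero; suc; _∸_; _<_; s≤s⁻¹)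
  open import Data.Nat.Properties using (≤-<-trans; m∸n≤m; n<1+n)
  open import Data.Integer as ℤ using (+_)
  open import Data.Rational using (0ℚ; _+_; _*_)
  open import Data.List using (upTo; length)
  open import Data.Maybe using (just; nothing; maybe′)
  open import Data.Product using (_×_; _,_; proj₁; proj₂)
  open import Relation.Binary.PropositionalEquality
  open import Defs
  open Sums
  open DivisorSums
  open CauchyProduct
  open SeriesRing using (_≋_; mk; un; t⊛-coef-zero; t⊛-coef-suc)

  Agree : ℕ → Ser → Ser → Set
  Agree N A B = ∀ n → n < N → ∀ m → A n m ≡ B n m

  agree-refl : ∀ {N A} → Agree N A A
  agree-refl _ _ _ = refl

  agree-⊕ : ∀ {N A A′ B B′} → Agree N A A′ → Agree N B B′ → Agree N (A ⊕ B) (A′ ⊕ B′)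
  agree-⊕ ea eb n n<N m = cong₂ _+_ (ea n n<N m) (eb n n<N m)

  agree-⊛ : ∀ {N A A′ B B′} → Agree N A A′ → Agree N B B′ → Agree N (A ⊛ B) (A′ ⊛ B′)
  agree-⊛ {N} {A} {A′} {B} {B′} ea eb n n<N m = begin
    (A ⊛ B) n m      ≡⟨ ⊛-conv A B n m ⟩
    conv A B n e     ≡⟨ ∑<-cong (suc n) (λ j j≤n → ∑div-cong e (λ d → cong₂ _*_
                          (ea j (≤-<-trans (s≤s⁻¹ j≤n) n<N) (fromList d))
                          (eb (n ∸ j) (≤-<-trans (m∸n≤m n j) n<N) _))) ⟩
    conv A′ B′ n e   ≡⟨ ⊛-conv A′ B′ n m ⟨
    (A′ ⊛ B′) n m    ∎
    where
    open ≡-Reasoning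
    e = toList m

  agree-zSum : ∀ {N} (X Y : ℕ → Ser) → (∀ i → Agree N (X i) (Y i)) → Agree N (zSum X) (zSum Y)
  agree-zSum X Y e n n<N m = ∑-cong (upTo (length (toList m))) (λ i → go i (decAt i (toList m)))
    where
    go : ∀ i mb → maybe′ (λ l → X (suc i) n (fromList l)) 0ℚ mb ≡ maybe′ (λ l → Y (suc i) n (fromList l)) 0ℚ mb
    go i nothing  = refl
    go i (just l) = e (suc i) n n<N (fromList l)

  agree-t⊛ : ∀ {N X X′} → Agree N X X′ → Agree (suc N) (tS ⊛ X) (tS ⊛ X′)
  agree-t⊛ {X = X} {X′} e zero    _     m = trans (t⊛-coef-zero X m) (sym (t⊛-coef-zero X′ m))
  agree-t⊛ {X = X} {X′} e (suc n) n<1+N m =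
    trans (t⊛-coef-suc X n m) (trans (e n (s≤s⁻¹ n<1+N) m) (sym (t⊛-coef-suc X′ n m)))

  agree-≋ : ∀ {N A A′ B B′} → A ≋ A′ → B ≋ B′ → Agree N A′ B′ → Agree N A B
  agree-≋ ea eb e n n<N m = trans (un ea n m) (trans (e n n<N m) (sym (un eb n m)))

  module _ {N : ℕ} {S₁ S₂ S₁′ S₂′ : Ser} (e₁ : Agree N S₁ S₁′) (e₂ : Agree N S₂ S₂′) where

    agree-Ppow : ∀ k j → Agree N (Ppow S₁ S₂ k j) (Ppow S₁′ S₂′ k j)
    agree-Ppow zero    j = agree-refl
    agree-Ppow (suc k) j = agree-⊕ (agree-⊕ (agree-Ppow k (ℤ.pred j)) (agree-⊛ e₁ (agree-Ppow k j)))
                                   (agree-⊛ e₂ (agree-Ppow k (ℤ.suc j)))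

    agree-W : ∀ j → Agree N (W S₁ S₂ j) (W S₁′ S₂′ j)
    agree-W j = agree-zSum _ _ (λ i → agree-Ppow (i ∸ 1) j)

  -- Because of the factor t, agreement of two solutions below order N propagates to order N + 1.
  S-system-unique : ∀ {S₁ S₂ S₁′ S₂′ : Ser}
    → S₁ ≋ tS ⊛ W S₁ S₂ (+ 0) → S₂ ≋ tS ⊕ tS ⊛ W S₁ S₂ (neg 1)
    → S₁′ ≋ tS ⊛ W S₁′ S₂′ (+ 0) → S₂′ ≋ tS ⊕ tS ⊛ W S₁′ S₂′ (neg 1)
    → (S₁ ≋ S₁′) × (S₂ ≋ S₂′)
  S-system-unique {S₁} {S₂} {S₁′} {S₂′} h₁ h₂ h₁′ h₂′ =
    mk (λ n → proj₁ (agreeBelow (suc n)) n (n<1+n n)) , mk (λ n → proj₂ (agreeBelow (suc n)) n (n<1+n n))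
    where
    agreeBelow : ∀ N → Agree N S₁ S₁′ × Agree N S₂ S₂′
    agreeBelow zero    = (λ _ ()) , (λ _ ())
    agreeBelow (suc N) with agreeBelow N
    ... | a₁ , a₂ = agree-≋ h₁ h₁′ (agree-t⊛ (agree-W a₁ a₂ (+ 0)))
                  , agree-≋ h₂ h₂′ (agree-⊕ {A = tS} agree-refl (agree-t⊛ (agree-W a₁ a₂ (neg 1))))

module LaurentSeries where

  open import Data.Nat as ℕ using (ℕ; zero; suc; _∸_)
  open import Data.Integer as ℤ using (ℤ; +_; -[1+_])
  open import Data.Rational using (0ℚ; 1ℚ; _/_)
  open import Relation.Binary.PropositionalEquality using (_≡_; refl; cong)
  open import Defs
  open SeriesRing
  open ZSums
  open Solver

  module _ (S₁ S₂ : Ser) where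

    -- Coefficientwise form of X(S₂/v) = X(v), a symmetry of P = v + S₁ + S₂/v.
    Symmetric : LSer → Set
    Symmetric X = ∀ n → X (neg n) ≋ (S₂ ^S n) ⊛ X (+ n)

    mulP-symmetric : ∀ X → Symmetric X → Symmetric (mulP S₁ S₂ X)
    mulP-symmetric X h zero    = ≋-sym (solve 1 (λ x → con 1ℚ :* x := x) ≋-refl (mulP S₁ S₂ X (+ 0)))
    mulP-symmetric X h (suc n) = begin
      X (ℤ.pred -[1+ n ]) ⊕ S₁ ⊛ X -[1+ n ] ⊕ S₂ ⊛ X (ℤ.suc -[1+ n ])
        ≈⟨ h (suc (suc n)) ⊕≋ same S₁ ⊛≋ h (suc n) ⊕≋ same S₂ ⊛≋ ≋-trans (≡⇒≋ (cong X (suc-neg n))) (h n) ⟩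
      (S₂ ⊛ (S₂ ⊛ (S₂ ^S n))) ⊛ X (+ suc (suc n)) ⊕ S₁ ⊛ ((S₂ ⊛ (S₂ ^S n)) ⊛ X (+ suc n)) ⊕ S₂ ⊛ ((S₂ ^S n) ⊛ X (+ n))
        ≈⟨ solve 6 (λ s₁ s₂ p a b c → (s₂ :* (s₂ :* p)) :* c :+ s₁ :* ((s₂ :* p) :* b) :+ s₂ :* (p :* a)
                                     := (s₂ :* p) :* (a :+ s₁ :* b :+ s₂ :* c))
                   ≋-refl S₁ S₂ (S₂ ^S n) (X (+ n)) (X (+ suc n)) (X (+ suc (suc n))) ⟩
      (S₂ ⊛ (S₂ ^S n)) ⊛ (X (+ n) ⊕ S₁ ⊛ X (+ suc n) ⊕ S₂ ⊛ X (+ suc (suc n))) ∎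
      where
      open ≋-Reasoning
      suc-neg : ∀ n → ℤ.suc -[1+ n ] ≡ neg n
      suc-neg zero    = refl
      suc-neg (suc n) = refl

    δ₀-symmetric : Symmetric δ₀
    δ₀-symmetric zero    = ≋-sym (solve 0 (con 1ℚ :* con 1ℚ := con 1ℚ) ≋-refl)
    δ₀-symmetric (suc n) = ≋-sym (solve 1 (λ p → p :* con 0ℚ := con 0ℚ) ≋-refl (S₂ ^S suc n))

    Ppow-symmetric : ∀ k → Symmetric (Ppow S₁ S₂ k)
    Ppow-symmetric zero    = δ₀-symmetric
    Ppow-symmetric (suc k) = mulP-symmetric (Ppow S₁ S₂ k) (Ppow-symmetric k)

    W-symmetric : Symmetric (W S₁ S₂)
    W-symmetric n = ≋-trans (zSum-cong (λ i → Ppow S₁ S₂ (i ∸ 1) (neg n)) (λ i → (S₂ ^S n) ⊛ Ppow S₁ S₂ (i ∸ 1) (+ n))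
                                       (λ i → Ppow-symmetric i n))
                            (≋-sym (⊛-zSum (S₂ ^S n) (λ i → Ppow S₁ S₂ (i ∸ 1) (+ n))))

    PkW-symmetric : ∀ k → Symmetric (PkW S₁ S₂ k)
    PkW-symmetric zero    = W-symmetric
    PkW-symmetric (suc k) = mulP-symmetric (PkW S₁ S₂ k) (PkW-symmetric k)

    -- By symmetry [v⁻¹]X = S₂ [v¹]X, so v and S₂/v contribute equally to the constant term.
    mulP-constant : ∀ X → Symmetric X → mulP S₁ S₂ X (+ 0) ≋ S₁ ⊛ X (+ 0) ⊕ cst (+ 2 / 1) ⊛ (S₂ ⊛ X (+ 1))
    mulP-constant X h = ≋-trans (h 1 ⊕≋ same (S₁ ⊛ X (+ 0)) ⊕≋ same (S₂ ⊛ X (+ 1)))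
      (solve 4 (λ s₁ s₂ x₀ x₁ → (s₂ :* con 1ℚ) :* x₁ :+ s₁ :* x₀ :+ s₂ :* x₁ := s₁ :* x₀ :+ con (+ 2 / 1) :* (s₂ :* x₁))
             ≋-refl S₁ S₂ (X (+ 0)) (X (+ 1)))

    PkW-as-zSum : ∀ k j → PkW S₁ S₂ k j ≋ zSum (λ i → Ppow S₁ S₂ (k ℕ.+ (i ∸ 1)) j)
    PkW-as-zSum zero    j = ≋-refl
    PkW-as-zSum (suc k) j = begin
      PkW S₁ S₂ k (ℤ.pred j) ⊕ S₁ ⊛ PkW S₁ S₂ k j ⊕ S₂ ⊛ PkW S₁ S₂ k (ℤ.suc j)
        ≈⟨ PkW-as-zSum k (ℤ.pred j) ⊕≋ ≋-trans (same S₁ ⊛≋ PkW-as-zSum k j) (⊛-zSum S₁ (T j))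
                                    ⊕≋ ≋-trans (same S₂ ⊛≋ PkW-as-zSum k (ℤ.suc j)) (⊛-zSum S₂ (T (ℤ.suc j))) ⟩
      zSum (T (ℤ.pred j)) ⊕ zSum (λ i → S₁ ⊛ T j i) ⊕ zSum (λ i → S₂ ⊛ T (ℤ.suc j) i)
        ≈⟨ ≋-sym (≋-trans (zSum-⊕ (λ i → T (ℤ.pred j) i ⊕ S₁ ⊛ T j i) (λ i → S₂ ⊛ T (ℤ.suc j) i))
                          (zSum-⊕ (T (ℤ.pred j)) (λ i → S₁ ⊛ T j i) ⊕≋ same (zSum (λ i → S₂ ⊛ T (ℤ.suc j) i)))) ⟩
      zSum (λ i → Ppow S₁ S₂ (suc k ℕ.+ (i ∸ 1)) j) ∎
      where
      open ≋-Reasoning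
      T : ℤ → ℕ → Ser
      T j′ i = Ppow S₁ S₂ (k ℕ.+ (i ∸ 1)) j′

module Scalars where

  open import Data.Nat using (ℕ; zero; suc)
  open import Data.Nat.Coprimality as Coprime using (1-coprimeTo)
  open import Data.Integer as ℤ using (ℤ; +_; -[1+_])
  open import Data.Integer.Properties as ℤ using ()
  open import Data.Rational using (mkℚ; 0ℚ; 1ℚ; _/_; _+_; _*_)
  open import Data.Rational.Properties using (↥p/↧p≡p; *-inverseʳ; *-comm; 0/n≡0)
  open import Relation.Binary.PropositionalEquality
  open import Algebra.Solver.Ring.AlmostCommutativeRing using (_-Raw-AlmostCommutative⟶_)
  open import Defs
  open SeriesRing
  open Solver
  open _-Raw-AlmostCommutative⟶_ cst-homomorphism using (+-homo; *-homo)

  private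
    n/1≡mkℚ : ∀ k → + k / 1 ≡ mkℚ (+ k) 0 (Coprime.sym (1-coprimeTo k))
    n/1≡mkℚ k = ↥p/↧p≡p (mkℚ (+ k) 0 (Coprime.sym (1-coprimeTo k)))

    1/n≡mkℚ : ∀ k → + 1 / suc k ≡ mkℚ (+ 1) k (1-coprimeTo (suc k))
    1/n≡mkℚ k = ↥p/↧p≡p (mkℚ (+ 1) k (1-coprimeTo (suc k)))

  suc/1≡/1+1 : ∀ k → + suc k / 1 ≡ + k / 1 + 1ℚ
  suc/1≡/1+1 k = begin
    + suc k / 1                                   ≡⟨ cong (_/ 1) (trans (ℤ.+-comm (+ 1) (+ k))
                                                                        (cong (ℤ._+ + 1) (sym (ℤ.*-identityʳ (+ k))))) ⟩
    (+ k ℤ.* + 1 ℤ.+ + 1 ℤ.* + 1) / 1            ≡⟨⟩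
    mkℚ (+ k) 0 (Coprime.sym (1-coprimeTo k)) + 1ℚ ≡⟨ cong (_+ 1ℚ) (n/1≡mkℚ k) ⟨
    + k / 1 + 1ℚ                                  ∎
    where open ≡-Reasoning

  1/suc*suc/1≡1 : ∀ k → + 1 / suc k * (+ suc k / 1) ≡ 1ℚ
  1/suc*suc/1≡1 k = trans (*-comm (+ 1 / suc k) _)
    (trans (cong₂ _*_ (n/1≡mkℚ (suc k)) (1/n≡mkℚ k)) (*-inverseʳ (mkℚ (+ suc k) 0 (Coprime.sym (1-coprimeTo (suc k))))))

  natS : ℕ → Ser
  natS zero    = 0S
  natS (suc k) = natS k ⊕ 1S

  intS : ℤ → Ser
  intS (+ n)    = natS n
  intS -[1+ n ] = -S natS (suc n)

  natS-cst : ∀ k → natS k ≋ cst (+ k / 1)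
  natS-cst zero    = ≡⇒≋ (cong cst (sym (0/n≡0 1)))
  natS-cst (suc k) = ≋-trans (natS-cst k ⊕≋ same 1S)
                             (≋-trans (≋-sym (+-homo (+ k / 1) 1ℚ)) (≡⇒≋ (cong cst (sym (suc/1≡/1+1 k)))))

  cst-inverse-natS : ∀ k → cst (+ 1 / suc k) ⊛ natS (suc k) ≋ 1S
  cst-inverse-natS k = ≋-trans (same (cst (+ 1 / suc k)) ⊛≋ natS-cst (suc k))
    (≋-trans (≋-sym (*-homo (+ 1 / suc k) (+ suc k / 1))) (≡⇒≋ (cong cst (1/suc*suc/1≡1 k))))

  natS-cancel : ∀ k {X Y} → natS (suc k) ⊛ X ≋ natS (suc k) ⊛ Y → X ≋ Y
  natS-cancel k {X} {Y} e = begin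
    X                        ≈⟨ solve 1 (λ x → x := con 1ℚ :* x) ≋-refl X ⟩
    1S ⊛ X                   ≈⟨ ≋-sym (cst-inverse-natS k) ⊛≋ same X ⟩
    (c ⊛ natS (suc k)) ⊛ X   ≈⟨ solve 3 (λ c n x → (c :* n) :* x := c :* (n :* x)) ≋-refl c (natS (suc k)) X ⟩
    c ⊛ (natS (suc k) ⊛ X)   ≈⟨ same c ⊛≋ e ⟩
    c ⊛ (natS (suc k) ⊛ Y)   ≈⟨ solve 3 (λ c n x → c :* (n :* x) := (c :* n) :* x) ≋-refl c (natS (suc k)) Y ⟩
    (c ⊛ natS (suc k)) ⊛ Y   ≈⟨ cst-inverse-natS k ⊛≋ same Y ⟩
    1S ⊛ Y                   ≈⟨ solve 1 (λ x → con 1ℚ :* x := x) ≋-refl Y ⟩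
    Y                        ∎
    where
    open ≋-Reasoning
    c = cst (+ 1 / suc k)

  intS-suc : ∀ j → intS (ℤ.suc j) ≋ intS j ⊕ 1S
  intS-suc (+ n)          = ≋-refl
  intS-suc -[1+ zero ]    = solve 0 (con 0ℚ := :- (con 0ℚ :+ con 1ℚ) :+ con 1ℚ) ≋-refl
  intS-suc -[1+ suc n ]   = solve 1 (λ x → :- x := :- (x :+ con 1ℚ) :+ con 1ℚ) ≋-refl (natS (suc n))

  intS-pred : ∀ j → intS (ℤ.pred j) ≋ intS j ⊖ 1S
  intS-pred (+ zero)      = solve 0 (:- (con 0ℚ :+ con 1ℚ) := con 0ℚ :- con 1ℚ) ≋-refl
  intS-pred (+ suc n)     = solve 1 (λ x → x := (x :+ con 1ℚ) :- con 1ℚ) ≋-refl (natS n)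
  intS-pred -[1+ n ]      = solve 1 (λ x → :- (x :+ con 1ℚ) := :- x :- con 1ℚ) ≋-refl (natS (suc n))

module SeriesSums where

  open import Function using (_∘_)
  open import Data.Nat as ℕ using (ℕ; zero; suc; _≤_)
  open import Data.Nat.Properties using (m≤n+m)
  open import Data.Rational using (0ℚ)
  open import Data.List using (List; []; _∷_; map; upTo)
  open import Data.List.Properties using (map-upTo; map-applyUpTo)
  open import Relation.Binary.PropositionalEquality using (cong; trans; sym)
  open import Defs
  open SeriesRing
  open Solver

  private variable A : Set

  ∑S : ℕ → (ℕ → Ser) → Ser
  ∑S n F = sumS (map F (upTo n))

  sumS-cong : (xs : List A) {F G : A → Ser} → (∀ x → F x ≋ G x) → sumS (map F xs) ≋ sumS (map G xs)
  sumS-cong []       e = ≋-refl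
  sumS-cong (x ∷ xs) e = e x ⊕≋ sumS-cong xs e

  sumS-⊕ : (xs : List A) (F G : A → Ser) → sumS (map (λ x → F x ⊕ G x) xs) ≋ sumS (map F xs) ⊕ sumS (map G xs)
  sumS-⊕ []       F G = solve 0 (con 0ℚ := con 0ℚ :+ con 0ℚ) ≋-refl
  sumS-⊕ (x ∷ xs) F G = ≋-trans (same (F x ⊕ G x) ⊕≋ sumS-⊕ xs F G)
    (solve 4 (λ a b c d → (a :+ b) :+ (c :+ d) := (a :+ c) :+ (b :+ d)) ≋-refl (F x) (G x) (sumS (map F xs)) (sumS (map G xs)))

  ⊛-distribˡ-sumS : (xs : List A) (B : Ser) (F : A → Ser) → B ⊛ sumS (map F xs) ≋ sumS (map (λ x → B ⊛ F x) xs)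
  ⊛-distribˡ-sumS []       B F = solve 1 (λ b → b :* con 0ℚ := con 0ℚ) ≋-refl B
  ⊛-distribˡ-sumS (x ∷ xs) B F =
    ≋-trans (solve 3 (λ b a s → b :* (a :+ s) := b :* a :+ b :* s) ≋-refl B (F x) (sumS (map F xs)))
            (same (B ⊛ F x) ⊕≋ ⊛-distribˡ-sumS xs B F)

  ∑S-cong : ∀ n {F G : ℕ → Ser} → (∀ k → F k ≋ G k) → ∑S n F ≋ ∑S n G
  ∑S-cong n = sumS-cong (upTo n)

  ∑S-⊕ : ∀ n (F G : ℕ → Ser) → ∑S n (λ k → F k ⊕ G k) ≋ ∑S n F ⊕ ∑S n G
  ∑S-⊕ n = sumS-⊕ (upTo n)

  ⊛-distribˡ-∑S : ∀ n (B : Ser) (F : ℕ → Ser) → B ⊛ ∑S n F ≋ ∑S n (λ k → B ⊛ F k)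
  ⊛-distribˡ-∑S n = ⊛-distribˡ-sumS (upTo n)

  ∑S-suc : ∀ n F → ∑S (suc n) F ≋ F 0 ⊕ ∑S n (F ∘ suc)
  ∑S-suc n F = ≡⇒≋ (cong (F 0 ⊕_) (trans (cong sumS (map-applyUpTo suc F n)) (sym (cong sumS (map-upTo (F ∘ suc) n)))))

  ∑S-vanishes : ∀ n {F : ℕ → Ser} → (∀ k → F k ≋ 0S) → ∑S n F ≋ 0S
  ∑S-vanishes zero    e = ≋-refl
  ∑S-vanishes (suc n) {F} e = ≋-trans (∑S-suc n F)
    (≋-trans (e 0 ⊕≋ ∑S-vanishes n (λ k → e (suc k))) (solve 0 (con 0ℚ :+ con 0ℚ := con 0ℚ) ≋-refl))

  ∑S-snoc : ∀ n F → ∑S (suc n) F ≋ ∑S n F ⊕ F n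
  ∑S-snoc zero    F = solve 1 (λ x → x :+ con 0ℚ := con 0ℚ :+ x) ≋-refl (F 0)
  ∑S-snoc (suc n) F = begin
    ∑S (suc (suc n)) F                 ≈⟨ ∑S-suc (suc n) F ⟩
    F 0 ⊕ ∑S (suc n) (F ∘ suc)         ≈⟨ same (F 0) ⊕≋ ∑S-snoc n (F ∘ suc) ⟩
    F 0 ⊕ (∑S n (F ∘ suc) ⊕ F (suc n)) ≈⟨ solve 3 (λ a b c → a :+ (b :+ c) := (a :+ b) :+ c) ≋-refl (F 0) (∑S n (F ∘ suc)) (F (suc n)) ⟩
    (F 0 ⊕ ∑S n (F ∘ suc)) ⊕ F (suc n) ≈⟨ ≋-sym (∑S-suc n F) ⊕≋ same (F (suc n)) ⟩
    ∑S (suc n) F ⊕ F (suc n)           ∎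
    where open ≋-Reasoning

  ∑S-extend : ∀ n d (F : ℕ → Ser) → (∀ k → n ≤ k → F k ≋ 0S) → ∑S (d ℕ.+ n) F ≋ ∑S n F
  ∑S-extend n zero    F e = ≋-refl
  ∑S-extend n (suc d) F e = ≋-trans (∑S-snoc (d ℕ.+ n) F)
    (≋-trans (∑S-extend n d F e ⊕≋ e (d ℕ.+ n) (m≤n+m n d)) (solve 1 (λ x → x :+ con 0ℚ := x) ≋-refl (∑S n F)))

  ∑S-shift : ∀ n F → F 0 ≋ 0S → ∑S n (F ∘ suc) ≋ ∑S n F ⊕ F n
  ∑S-shift n F e = begin
    ∑S n (F ∘ suc)        ≈⟨ solve 1 (λ y → y := con 0ℚ :+ y) ≋-refl (∑S n (F ∘ suc)) ⟩
    0S ⊕ ∑S n (F ∘ suc)   ≈⟨ ≋-sym e ⊕≋ same (∑S n (F ∘ suc)) ⟩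
    F 0 ⊕ ∑S n (F ∘ suc)  ≈⟨ ≋-sym (∑S-suc n F) ⟩
    ∑S (suc n) F          ≈⟨ ∑S-snoc n F ⟩
    ∑S n F ⊕ F n          ∎
    where open ≋-Reasoning

module CentralCoefficients where

  open import Data.Nat using (ℕ; zero; suc)
  open import Data.Integer as ℤ using (ℤ; +_; -[1+_])
  open import Data.Integer.Properties using (suc-pred; pred-suc)
  open import Data.Rational using (0ℚ; 1ℚ; _/_)
  open import Relation.Binary.PropositionalEquality using (cong)
  open import Defs
  open SeriesRing
  open Scalars
  open LaurentSeries
  open Solver

  module _ (S₁ S₂ : Ser) where
    private
      p = Ppow S₁ S₂

    -- [vʲ] Pᵐ⁻¹·(v − S₂/v); since v·dP/dv = v − S₂/v, the Euler derivative of Pᵐ is m times this.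
    dPpow : ℕ → ℤ → Ser
    dPpow zero    j = 0S
    dPpow (suc m) j = p m (ℤ.pred j) ⊖ S₂ ⊛ p m (ℤ.suc j)

    dPpow-mulP : ∀ m j → mulP S₁ S₂ (dPpow (suc m)) j ≋ dPpow (suc (suc m)) j
    dPpow-mulP m j = begin
      (p m (ℤ.pred (ℤ.pred j)) ⊖ S₂ ⊛ p m (ℤ.suc (ℤ.pred j))) ⊕ S₁ ⊛ (p m (ℤ.pred j) ⊖ S₂ ⊛ p m (ℤ.suc j))
        ⊕ S₂ ⊛ (p m (ℤ.pred (ℤ.suc j)) ⊖ S₂ ⊛ p m (ℤ.suc (ℤ.suc j)))
        ≈⟨ (same x₋₂ ⊖≋ same S₂ ⊛≋ suc-pred≋) ⊕≋ same (S₁ ⊛ (x₋₁ ⊖ S₂ ⊛ x₁)) ⊕≋ same S₂ ⊛≋ (pred-suc≋ ⊖≋ same (S₂ ⊛ x₂)) ⟩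
      (x₋₂ ⊖ S₂ ⊛ x₀) ⊕ S₁ ⊛ (x₋₁ ⊖ S₂ ⊛ x₁) ⊕ S₂ ⊛ (x₀ ⊖ S₂ ⊛ x₂)
        ≈⟨ solve 7 (λ s₁ s₂ a b c d e → (a :- s₂ :* c) :+ s₁ :* (b :- s₂ :* d) :+ s₂ :* (c :- s₂ :* e)
                                       := (a :+ s₁ :* b :+ s₂ :* c) :- s₂ :* (c :+ s₁ :* d :+ s₂ :* e))
                   ≋-refl S₁ S₂ x₋₂ x₋₁ x₀ x₁ x₂ ⟩
      (x₋₂ ⊕ S₁ ⊛ x₋₁ ⊕ S₂ ⊛ x₀) ⊖ S₂ ⊛ (x₀ ⊕ S₁ ⊛ x₁ ⊕ S₂ ⊛ x₂)
        ≈⟨ (same (x₋₂ ⊕ S₁ ⊛ x₋₁) ⊕≋ same S₂ ⊛≋ ≋-sym suc-pred≋)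
           ⊖≋ same S₂ ⊛≋ (≋-sym pred-suc≋ ⊕≋ same (S₁ ⊛ x₁) ⊕≋ same (S₂ ⊛ x₂)) ⟩
      p (suc m) (ℤ.pred j) ⊖ S₂ ⊛ p (suc m) (ℤ.suc j) ∎
      where
      open ≋-Reasoning
      x₋₂ = p m (ℤ.pred (ℤ.pred j))
      x₋₁ = p m (ℤ.pred j)
      x₀  = p m j
      x₁  = p m (ℤ.suc j)
      x₂  = p m (ℤ.suc (ℤ.suc j))
      suc-pred≋ : p m (ℤ.suc (ℤ.pred j)) ≋ x₀
      suc-pred≋ = ≡⇒≋ (cong (p m) (suc-pred j))
      pred-suc≋ : p m (ℤ.pred (ℤ.suc j)) ≋ x₀
      pred-suc≋ = ≡⇒≋ (cong (p m) (pred-suc j))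

    euler-Ppow : ∀ m j → intS j ⊛ p m j ≋ natS m ⊛ dPpow m j
    euler-Ppow zero    (+ zero)   = solve 0 (con 0ℚ :* con 1ℚ := con 0ℚ :* con 0ℚ) ≋-refl
    euler-Ppow zero    (+ suc n)  = solve 1 (λ x → x :* con 0ℚ := con 0ℚ :* con 0ℚ) ≋-refl (intS (+ suc n))
    euler-Ppow zero    -[1+ n ]   = solve 1 (λ x → x :* con 0ℚ := con 0ℚ :* con 0ℚ) ≋-refl (intS -[1+ n ])
    euler-Ppow (suc m) j = begin
      J ⊛ (a ⊕ S₁ ⊛ b ⊕ S₂ ⊛ c)
        ≈⟨ solve 6 (λ J s₁ s₂ a b c → J :* (a :+ s₁ :* b :+ s₂ :* c)
                     := (J :- con 1ℚ) :* a :+ s₁ :* (J :* b) :+ s₂ :* ((J :+ con 1ℚ) :* c) :+ (a :- s₂ :* c))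
                   ≋-refl J S₁ S₂ a b c ⟩
      (J ⊖ 1S) ⊛ a ⊕ S₁ ⊛ (J ⊛ b) ⊕ S₂ ⊛ ((J ⊕ 1S) ⊛ c) ⊕ d
        ≈⟨ ≋-trans (≋-sym (intS-pred j) ⊛≋ same a) (euler-Ppow m (ℤ.pred j))
           ⊕≋ same S₁ ⊛≋ euler-Ppow m j
           ⊕≋ same S₂ ⊛≋ ≋-trans (≋-sym (intS-suc j) ⊛≋ same c) (euler-Ppow m (ℤ.suc j))
           ⊕≋ same d ⟩
      M ⊛ dPpow m (ℤ.pred j) ⊕ S₁ ⊛ (M ⊛ dPpow m j) ⊕ S₂ ⊛ (M ⊛ dPpow m (ℤ.suc j)) ⊕ d
        ≈⟨ solve 6 (λ M s₁ s₂ x y z → M :* x :+ s₁ :* (M :* y) :+ s₂ :* (M :* z) := M :* (x :+ s₁ :* y :+ s₂ :* z))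
                   ≋-refl M S₁ S₂ (dPpow m (ℤ.pred j)) (dPpow m j) (dPpow m (ℤ.suc j)) ⊕≋ same d ⟩
      M ⊛ mulP S₁ S₂ (dPpow m) j ⊕ d
        ≈⟨ natS-mulP-dPpow m ⊕≋ same d ⟩
      M ⊛ d ⊕ d
        ≈⟨ solve 2 (λ M x → M :* x :+ x := (M :+ con 1ℚ) :* x) ≋-refl M d ⟩
      (M ⊕ 1S) ⊛ d ∎
      where
      open ≋-Reasoning
      J = intS j
      M = natS m
      a = p m (ℤ.pred j)
      b = p m j
      c = p m (ℤ.suc j)
      d = a ⊖ S₂ ⊛ c
      natS-mulP-dPpow : ∀ m → natS m ⊛ mulP S₁ S₂ (dPpow m) j ≋ natS m ⊛ dPpow (suc m) j
      natS-mulP-dPpow zero    = solve 2 (λ x y → con 0ℚ :* x := con 0ℚ :* y) ≋-refl (mulP S₁ S₂ (dPpow zero) j) (dPpow 1 j)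
      natS-mulP-dPpow (suc m) = same (natS (suc m)) ⊛≋ dPpow-mulP m j

    central : ℕ → Ser
    central m = p m (+ 0)

    central-suc : ∀ m → central (suc m) ≋ S₁ ⊛ central m ⊕ cst (+ 2 / 1) ⊛ (S₂ ⊛ p m (+ 1))
    central-suc m = mulP-constant S₁ S₂ (p m) (Ppow-symmetric S₁ S₂ m)

    private
      two four : Ser
      two  = cst (+ 2 / 1)
      four = cst (+ 4 / 1)

    Ppow-one : ∀ m → (natS (suc m) ⊕ 1S) ⊛ p (suc m) (+ 1) ≋ natS (suc m) ⊛ (two ⊛ central m ⊕ S₁ ⊛ p m (+ 1))
    Ppow-one m = begin
      (M ⊕ 1S) ⊛ w
        ≈⟨ solve 2 (λ M w → (M :+ con 1ℚ) :* w := M :* w :+ (con 0ℚ :+ con 1ℚ) :* w) ≋-refl M w ⟩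
      M ⊛ (c₀ ⊕ S₁ ⊛ u ⊕ S₂ ⊛ v) ⊕ intS (+ 1) ⊛ w
        ≈⟨ same (M ⊛ (c₀ ⊕ S₁ ⊛ u ⊕ S₂ ⊛ v)) ⊕≋ euler-Ppow (suc m) (+ 1) ⟩
      M ⊛ (c₀ ⊕ S₁ ⊛ u ⊕ S₂ ⊛ v) ⊕ M ⊛ (c₀ ⊖ S₂ ⊛ v)
        ≈⟨ solve 6 (λ M s₁ s₂ c u v → M :* (c :+ s₁ :* u :+ s₂ :* v) :+ M :* (c :- s₂ :* v)
                                     := M :* (con (+ 2 / 1) :* c :+ s₁ :* u))
                   ≋-refl M S₁ S₂ c₀ u v ⟩
      M ⊛ (two ⊛ c₀ ⊕ S₁ ⊛ u) ∎
      where
      open ≋-Reasoning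
      M  = natS (suc m)
      w  = p (suc m) (+ 1)
      c₀ = central m
      u  = p m (+ 1)
      v  = p m (+ 2)

    central-recurrence : ∀ m → (natS (suc m) ⊕ 1S) ⊛ central (suc (suc m))
      ≋ (two ⊛ natS (suc m) ⊕ 1S) ⊛ S₁ ⊛ central (suc m) ⊕ natS (suc m) ⊛ (four ⊛ S₂ ⊖ S₁ ⊛ S₁) ⊛ central m
    central-recurrence m = begin
      (M ⊕ 1S) ⊛ c₂
        ≈⟨ same (M ⊕ 1S) ⊛≋ central-suc (suc m) ⟩
      (M ⊕ 1S) ⊛ (S₁ ⊛ c₁ ⊕ two ⊛ (S₂ ⊛ w))
        ≈⟨ solve 5 (λ M s₁ s₂ c₁ w → (M :+ con 1ℚ) :* (s₁ :* c₁ :+ con (+ 2 / 1) :* (s₂ :* w))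
                   := (con (+ 2 / 1) :* M :+ con 1ℚ) :* s₁ :* c₁ :- M :* s₁ :* c₁
                      :+ con (+ 2 / 1) :* s₂ :* ((M :+ con 1ℚ) :* w))
                   ≋-refl M S₁ S₂ c₁ w ⟩
      (two ⊛ M ⊕ 1S) ⊛ S₁ ⊛ c₁ ⊖ M ⊛ S₁ ⊛ c₁ ⊕ two ⊛ S₂ ⊛ ((M ⊕ 1S) ⊛ w)
        ≈⟨ same ((two ⊛ M ⊕ 1S) ⊛ S₁ ⊛ c₁) ⊖≋ same (M ⊛ S₁) ⊛≋ central-suc m ⊕≋ same (two ⊛ S₂) ⊛≋ Ppow-one m ⟩
      (two ⊛ M ⊕ 1S) ⊛ S₁ ⊛ c₁ ⊖ M ⊛ S₁ ⊛ (S₁ ⊛ c₀ ⊕ two ⊛ (S₂ ⊛ u)) ⊕ two ⊛ S₂ ⊛ (M ⊛ (two ⊛ c₀ ⊕ S₁ ⊛ u))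
        ≈⟨ solve 6 (λ M s₁ s₂ c₀ c₁ u →
                   (con (+ 2 / 1) :* M :+ con 1ℚ) :* s₁ :* c₁ :- M :* s₁ :* (s₁ :* c₀ :+ con (+ 2 / 1) :* (s₂ :* u))
                     :+ con (+ 2 / 1) :* s₂ :* (M :* (con (+ 2 / 1) :* c₀ :+ s₁ :* u))
                   := (con (+ 2 / 1) :* M :+ con 1ℚ) :* s₁ :* c₁ :+ M :* (con (+ 4 / 1) :* s₂ :- s₁ :* s₁) :* c₀)
                   ≋-refl M S₁ S₂ c₀ c₁ u ⟩
      (two ⊛ M ⊕ 1S) ⊛ S₁ ⊛ c₁ ⊕ M ⊛ (four ⊛ S₂ ⊖ S₁ ⊛ S₁) ⊛ c₀ ∎
      where
      open ≋-Reasoning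
      M  = natS (suc m)
      c₀ = central m
      c₁ = central (suc m)
      c₂ = central (suc (suc m))
      u  = p m (+ 1)
      w  = p (suc m) (+ 1)

module InverseSqrt where

  open import Function using (_∘_)
  open import Data.Nat as ℕ using (ℕ; zero; suc; _∸_; _<_; s≤s)
  open import Data.Nat.Properties using (<-trans; n<1+n; m≤n+m; +-suc)
  open import Data.Integer as ℤ using (ℤ; +_; -[1+_])
  open import Data.Rational as ℚ using (ℚ; 0ℚ; 1ℚ; _/_; ½)
  open import Relation.Binary.PropositionalEquality using (cong)
  open import Algebra.Solver.Ring.AlmostCommutativeRing using (_-Raw-AlmostCommutative⟶_)
  open import Defs
  open SeriesRing
  open Scalars
  open SeriesSums
  open Solver
  open _-Raw-AlmostCommutative⟶_ cst-homomorphism using (+-homo; *-homo; -‿homo)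

  module _ (R₁ R₂ : Ser) where

    A₁ A₂ : Ser
    A₁ = Rm1 R₁ R₂ 1
    A₂ = Rm1 R₁ R₂ 2

    private
      two : Ser
      two = cst (+ 2 / 1)

    -- Multiplication by R − 1 = A₁u + A₂u² on the coefficients of a u-series indexed by ℤ.
    mulR : (ℤ → Ser) → ℤ → Ser
    mulR X j = A₁ ⊛ X (ℤ.pred j) ⊕ A₂ ⊛ X (ℤ.pred (ℤ.pred j))

    Rpow : ℕ → ℤ → Ser
    Rpow zero    = δ₀
    Rpow (suc k) = mulR (Rpow k)

    -- [uʲ] (R − 1)ᵏ⁻¹ · u dR/du, the coefficients of the Euler derivative of (R − 1)ᵏ divided by k.
    dRpow : ℕ → ℤ → Ser
    dRpow zero    j = 0S
    dRpow (suc k) j = A₁ ⊛ Rpow k (ℤ.pred j) ⊕ two ⊛ (A₂ ⊛ Rpow k (ℤ.pred (ℤ.pred j)))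

    dRpow-mulR : ∀ k j → mulR (dRpow (suc k)) j ≋ dRpow (suc (suc k)) j
    dRpow-mulR k j = solve 5 (λ a₁ a₂ y₂ y₃ y₄ →
        a₁ :* (a₁ :* y₂ :+ con (+ 2 / 1) :* (a₂ :* y₃)) :+ a₂ :* (a₁ :* y₃ :+ con (+ 2 / 1) :* (a₂ :* y₄))
        := a₁ :* (a₁ :* y₂ :+ a₂ :* y₃) :+ con (+ 2 / 1) :* (a₂ :* (a₁ :* y₃ :+ a₂ :* y₄)))
      ≋-refl A₁ A₂ (Rpow k (ℤ.pred (ℤ.pred j))) (Rpow k (ℤ.pred (ℤ.pred (ℤ.pred j))))
                   (Rpow k (ℤ.pred (ℤ.pred (ℤ.pred (ℤ.pred j)))))

    euler-Rpow : ∀ k j → intS j ⊛ Rpow k j ≋ natS k ⊛ dRpow k j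
    euler-Rpow zero    (+ zero)  = solve 0 (con 0ℚ :* con 1ℚ := con 0ℚ :* con 0ℚ) ≋-refl
    euler-Rpow zero    (+ suc n) = solve 1 (λ x → x :* con 0ℚ := con 0ℚ :* con 0ℚ) ≋-refl (intS (+ suc n))
    euler-Rpow zero    -[1+ n ]  = solve 1 (λ x → x :* con 0ℚ := con 0ℚ :* con 0ℚ) ≋-refl (intS -[1+ n ])
    euler-Rpow (suc k) j = begin
      J ⊛ (A₁ ⊛ a ⊕ A₂ ⊛ b)
        ≈⟨ solve 5 (λ J a₁ a₂ a b → J :* (a₁ :* a :+ a₂ :* b)
                     := a₁ :* ((J :- con 1ℚ) :* a) :+ a₂ :* (((J :- con 1ℚ) :- con 1ℚ) :* b)
                        :+ (a₁ :* a :+ con (+ 2 / 1) :* (a₂ :* b)))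
                   ≋-refl J A₁ A₂ a b ⟩
      A₁ ⊛ ((J ⊖ 1S) ⊛ a) ⊕ A₂ ⊛ (((J ⊖ 1S) ⊖ 1S) ⊛ b) ⊕ d
        ≈⟨ same A₁ ⊛≋ ≋-trans (≋-sym (intS-pred j) ⊛≋ same a) (euler-Rpow k (ℤ.pred j))
           ⊕≋ same A₂ ⊛≋ ≋-trans (≋-trans (≋-sym (intS-pred j) ⊖≋ same 1S) (≋-sym (intS-pred (ℤ.pred j))) ⊛≋ same b)
                                 (euler-Rpow k (ℤ.pred (ℤ.pred j)))
           ⊕≋ same d ⟩
      A₁ ⊛ (K ⊛ dRpow k (ℤ.pred j)) ⊕ A₂ ⊛ (K ⊛ dRpow k (ℤ.pred (ℤ.pred j))) ⊕ d
        ≈⟨ solve 5 (λ a₁ a₂ K x y → a₁ :* (K :* x) :+ a₂ :* (K :* y) := K :* (a₁ :* x :+ a₂ :* y))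
                   ≋-refl A₁ A₂ K (dRpow k (ℤ.pred j)) (dRpow k (ℤ.pred (ℤ.pred j))) ⊕≋ same d ⟩
      K ⊛ mulR (dRpow k) j ⊕ d
        ≈⟨ natS-mulR-dRpow k ⊕≋ same d ⟩
      K ⊛ d ⊕ d
        ≈⟨ solve 2 (λ K x → K :* x :+ x := (K :+ con 1ℚ) :* x) ≋-refl K d ⟩
      natS (suc k) ⊛ d ∎
      where
      open ≋-Reasoning
      J = intS j
      K = natS k
      a = Rpow k (ℤ.pred j)
      b = Rpow k (ℤ.pred (ℤ.pred j))
      d = dRpow (suc k) j
      natS-mulR-dRpow : ∀ k → natS k ⊛ mulR (dRpow k) j ≋ natS k ⊛ dRpow (suc k) j
      natS-mulR-dRpow zero    = solve 2 (λ x y → con 0ℚ :* x := con 0ℚ :* y) ≋-refl (mulR (dRpow zero) j) (dRpow 1 j)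
      natS-mulR-dRpow (suc k) = same (natS (suc k)) ⊛≋ dRpow-mulR k j

    mulR-vanishes : ∀ X j → X (ℤ.pred j) ≋ 0S → X (ℤ.pred (ℤ.pred j)) ≋ 0S → mulR X j ≋ 0S
    mulR-vanishes X j e₁ e₂ = ≋-trans (same A₁ ⊛≋ e₁ ⊕≋ same A₂ ⊛≋ e₂)
                                      (solve 2 (λ a b → a :* con 0ℚ :+ b :* con 0ℚ := con 0ℚ) ≋-refl A₁ A₂)

    Rpow-negative : ∀ k n → Rpow k -[1+ n ] ≋ 0S
    Rpow-negative zero    n = ≋-refl
    Rpow-negative (suc k) n = mulR-vanishes (Rpow k) -[1+ n ] (Rpow-negative k (suc n)) (Rpow-negative k (suc (suc n)))

    Rpow-below : ∀ k n → n < k → Rpow k (+ n) ≋ 0S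
    Rpow-below (suc k) zero          _       = mulR-vanishes (Rpow k) (+ 0) (Rpow-negative k 0) (Rpow-negative k 1)
    Rpow-below (suc k) (suc zero)    (s≤s l) = mulR-vanishes (Rpow k) (+ 1) (Rpow-below k 0 l) (Rpow-negative k 0)
    Rpow-below (suc k) (suc (suc n)) (s≤s l) =
      mulR-vanishes (Rpow k) (+ suc (suc n)) (Rpow-below k (suc n) l) (Rpow-below k n (<-trans (n<1+n n) l))

    Rm1-pow : ∀ k ℓ → (Rm1 R₁ R₂ ^u k) ℓ ≋ Rpow k (+ ℓ)
    Rm1-pow zero    zero    = ≋-refl
    Rm1-pow zero    (suc ℓ) = ≋-refl
    Rm1-pow (suc k) zero    = ≋-trans (solve 1 (λ x → con 0ℚ :* x :+ con 0ℚ := con 0ℚ) ≋-refl (F 0))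
                                      (≋-sym (Rpow-below (suc k) 0 (s≤s ℕ.z≤n)))
      where F = Rm1 R₁ R₂ ^u k
    Rm1-pow (suc k) (suc zero) = begin
      0S ⊛ F 1 ⊕ (A₁ ⊛ F 0 ⊕ 0S)  ≈⟨ solve 2 (λ x y → con 0ℚ :* x :+ (y :+ con 0ℚ) := y) ≋-refl (F 1) (A₁ ⊛ F 0) ⟩
      A₁ ⊛ F 0                    ≈⟨ same A₁ ⊛≋ Rm1-pow k 0 ⟩
      A₁ ⊛ Rpow k (+ 0)           ≈⟨ solve 2 (λ x b → x := x :+ b :* con 0ℚ) ≋-refl (A₁ ⊛ Rpow k (+ 0)) A₂ ⟩
      A₁ ⊛ Rpow k (+ 0) ⊕ A₂ ⊛ 0S ≈⟨ same (A₁ ⊛ Rpow k (+ 0)) ⊕≋ same A₂ ⊛≋ ≋-sym (Rpow-negative k 0) ⟩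
      Rpow (suc k) (+ 1)          ∎
      where
      open ≋-Reasoning
      F = Rm1 R₁ R₂ ^u k
    Rm1-pow (suc k) (suc (suc ℓ)) = begin
      ∑S (3 ℕ.+ ℓ) G
        ≈⟨ ≋-trans (∑S-suc (2 ℕ.+ ℓ) G) (same (G 0) ⊕≋ ≋-trans (∑S-suc (suc ℓ) (G ∘ suc)) (same (G 1) ⊕≋ ∑S-suc ℓ (G ∘ suc ∘ suc))) ⟩
      G 0 ⊕ (G 1 ⊕ (G 2 ⊕ ∑S ℓ (G ∘ suc ∘ suc ∘ suc)))
        ≈⟨ same (G 0) ⊕≋ (same (G 1) ⊕≋ (same (G 2) ⊕≋ ∑S-vanishes ℓ (λ i → solve 1 (λ x → con 0ℚ :* x := con 0ℚ) ≋-refl (F (ℓ ∸ suc i))))) ⟩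
      G 0 ⊕ (G 1 ⊕ (G 2 ⊕ 0S))
        ≈⟨ solve 3 (λ x y z → con 0ℚ :* x :+ (y :+ (z :+ con 0ℚ)) := y :+ z) ≋-refl (F (suc (suc ℓ))) (G 1) (G 2) ⟩
      A₁ ⊛ F (suc ℓ) ⊕ A₂ ⊛ F ℓ
        ≈⟨ same A₁ ⊛≋ Rm1-pow k (suc ℓ) ⊕≋ same A₂ ⊛≋ Rm1-pow k ℓ ⟩
      Rpow (suc k) (+ suc (suc ℓ)) ∎
      where
      open ≋-Reasoning
      F = Rm1 R₁ R₂ ^u k
      G : ℕ → Ser
      G a = Rm1 R₁ R₂ a ⊛ F (suc (suc ℓ) ∸ a)

    private
      α : ℚ
      α = ℚ.- ½

    binom : ℕ → ℚ
    binom = gbinom α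

    kbinom : ℕ → Ser
    kbinom k = cst (binom k) ⊛ natS k

    cst-binom-suc : ∀ k → cst (binom (suc k)) ≋ cst (binom k) ⊛ (cst α ⊖ natS k) ⊛ cst (+ 1 / suc k)
    cst-binom-suc k = ≋-trans (*-homo (binom k ℚ.* (α ℚ.- (+ k / 1))) (+ 1 / suc k))
      (≋-trans (*-homo (binom k) (α ℚ.- (+ k / 1))) (same (cst (binom k)) ⊛≋ ≋-trans (+-homo α (ℚ.- (+ k / 1)))
                                                       (same (cst α) ⊕≋ ≋-trans (-‿homo (+ k / 1)) neg-natS))
       ⊛≋ same (cst (+ 1 / suc k)))
      where
      neg-natS : -S cst (+ k / 1) ≋ -S natS k
      neg-natS = mk λ n m → cong ℚ.-_ (un (≋-sym (natS-cst k)) n m)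

    binom-recurrence : ∀ k → kbinom (suc k) ⊕ kbinom k ≋ cst α ⊛ cst (binom k)
    binom-recurrence k = begin
      cst (binom (suc k)) ⊛ natS (suc k) ⊕ g ⊛ K
        ≈⟨ cst-binom-suc k ⊛≋ same (natS (suc k)) ⊕≋ same (g ⊛ K) ⟩
      g ⊛ (a ⊖ K) ⊛ i ⊛ natS (suc k) ⊕ g ⊛ K
        ≈⟨ solve 5 (λ g a K i N → g :* (a :- K) :* i :* N :+ g :* K := g :* (a :- K) :* (i :* N) :+ g :* K)
                   ≋-refl g a K i (natS (suc k)) ⟩
      g ⊛ (a ⊖ K) ⊛ (i ⊛ natS (suc k)) ⊕ g ⊛ K
        ≈⟨ same (g ⊛ (a ⊖ K)) ⊛≋ cst-inverse-natS k ⊕≋ same (g ⊛ K) ⟩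
      g ⊛ (a ⊖ K) ⊛ 1S ⊕ g ⊛ K
        ≈⟨ solve 3 (λ g a K → g :* (a :- K) :* con 1ℚ :+ g :* K := a :* g) ≋-refl g a K ⟩
      a ⊛ g ∎
      where
      open ≋-Reasoning
      g = cst (binom k)
      a = cst α
      K = natS k
      i = cst (+ 1 / suc k)

    -- Truncations of R^{-1/2} = Σ_k b_k (R − 1)ᵏ and of its Euler derivative.
    partialSum : ℕ → ℤ → Ser
    partialSum N j = ∑S N (λ k → cst (binom k) ⊛ Rpow k j)

    partialEuler : ℕ → ℤ → Ser
    partialEuler N j = ∑S N (λ k → kbinom (suc k) ⊛ dRpow (suc k) j)

    euler-partialSum : ∀ N j → intS j ⊛ partialSum (suc N) j ≋ partialEuler N j
    euler-partialSum N j = begin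
      intS j ⊛ partialSum (suc N) j
        ≈⟨ ⊛-distribˡ-∑S (suc N) (intS j) (λ k → cst (binom k) ⊛ Rpow k j) ⟩
      ∑S (suc N) (λ k → intS j ⊛ (cst (binom k) ⊛ Rpow k j))
        ≈⟨ ∑S-cong (suc N) (λ k → ≋-trans (solve 3 (λ J g h → J :* (g :* h) := g :* (J :* h)) ≋-refl (intS j) (cst (binom k)) (Rpow k j))
                                          (same (cst (binom k)) ⊛≋ euler-Rpow k j)) ⟩
      ∑S (suc N) (λ k → cst (binom k) ⊛ (natS k ⊛ dRpow k j))
        ≈⟨ ∑S-suc N (λ k → cst (binom k) ⊛ (natS k ⊛ dRpow k j)) ⟩
      cst 1ℚ ⊛ (0S ⊛ 0S) ⊕ ∑S N (λ k → cst (binom (suc k)) ⊛ (natS (suc k) ⊛ dRpow (suc k) j))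
        ≈⟨ ≋-trans (solve 1 (λ x → con 1ℚ :* (con 0ℚ :* con 0ℚ) :+ x := x) ≋-refl _)
                   (∑S-cong N (λ k → solve 3 (λ g n e → g :* (n :* e) := (g :* n) :* e) ≋-refl
                                             (cst (binom (suc k))) (natS (suc k)) (dRpow (suc k) j))) ⟩
      partialEuler N j ∎
      where open ≋-Reasoning

    mulR-partialEuler : ∀ N j → mulR (partialEuler N) j ≋ ∑S N (λ k → kbinom (suc k) ⊛ dRpow (suc (suc k)) j)
    mulR-partialEuler N j = begin
      A₁ ⊛ partialEuler N (ℤ.pred j) ⊕ A₂ ⊛ partialEuler N (ℤ.pred (ℤ.pred j))
        ≈⟨ ⊛-distribˡ-∑S N A₁ (λ k → kbinom (suc k) ⊛ dRpow (suc k) (ℤ.pred j))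
           ⊕≋ ⊛-distribˡ-∑S N A₂ (λ k → kbinom (suc k) ⊛ dRpow (suc k) (ℤ.pred (ℤ.pred j))) ⟩
      ∑S N (λ k → A₁ ⊛ (kbinom (suc k) ⊛ dRpow (suc k) (ℤ.pred j))) ⊕ ∑S N (λ k → A₂ ⊛ (kbinom (suc k) ⊛ dRpow (suc k) (ℤ.pred (ℤ.pred j))))
        ≈⟨ ≋-sym (∑S-⊕ N _ _) ⟩
      ∑S N (λ k → A₁ ⊛ (kbinom (suc k) ⊛ dRpow (suc k) (ℤ.pred j)) ⊕ A₂ ⊛ (kbinom (suc k) ⊛ dRpow (suc k) (ℤ.pred (ℤ.pred j))))
        ≈⟨ ∑S-cong N (λ k → ≋-trans (solve 5 (λ a₁ a₂ d x y → a₁ :* (d :* x) :+ a₂ :* (d :* y) := d :* (a₁ :* x :+ a₂ :* y))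
                                                ≋-refl A₁ A₂ (kbinom (suc k)) (dRpow (suc k) (ℤ.pred j)) (dRpow (suc k) (ℤ.pred (ℤ.pred j))))
                                         (same (kbinom (suc k)) ⊛≋ dRpow-mulR k j)) ⟩
      ∑S N (λ k → kbinom (suc k) ⊛ dRpow (suc (suc k)) j) ∎
      where open ≋-Reasoning

    dRpow-partialSum : ∀ N j → A₁ ⊛ partialSum N (ℤ.pred j) ⊕ two ⊛ (A₂ ⊛ partialSum N (ℤ.pred (ℤ.pred j)))
                             ≋ ∑S N (λ k → cst (binom k) ⊛ dRpow (suc k) j)
    dRpow-partialSum N j = begin
      A₁ ⊛ partialSum N (ℤ.pred j) ⊕ two ⊛ (A₂ ⊛ partialSum N (ℤ.pred (ℤ.pred j)))
        ≈⟨ ⊛-distribˡ-∑S N A₁ (λ k → g k ⊛ Rpow k (ℤ.pred j))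
           ⊕≋ ≋-trans (same two ⊛≋ ⊛-distribˡ-∑S N A₂ (λ k → g k ⊛ Rpow k (ℤ.pred (ℤ.pred j))))
                      (⊛-distribˡ-∑S N two (λ k → A₂ ⊛ (g k ⊛ Rpow k (ℤ.pred (ℤ.pred j))))) ⟩
      ∑S N (λ k → A₁ ⊛ (g k ⊛ Rpow k (ℤ.pred j))) ⊕ ∑S N (λ k → two ⊛ (A₂ ⊛ (g k ⊛ Rpow k (ℤ.pred (ℤ.pred j)))))
        ≈⟨ ≋-sym (∑S-⊕ N _ _) ⟩
      ∑S N (λ k → A₁ ⊛ (g k ⊛ Rpow k (ℤ.pred j)) ⊕ two ⊛ (A₂ ⊛ (g k ⊛ Rpow k (ℤ.pred (ℤ.pred j)))))
        ≈⟨ ∑S-cong N (λ k → solve 5 (λ a₁ a₂ g x y → a₁ :* (g :* x) :+ con (+ 2 / 1) :* (a₂ :* (g :* y))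
                                                    := g :* (a₁ :* x :+ con (+ 2 / 1) :* (a₂ :* y)))
                                    ≋-refl A₁ A₂ (g k) (Rpow k (ℤ.pred j)) (Rpow k (ℤ.pred (ℤ.pred j)))) ⟩
      ∑S N (λ k → g k ⊛ dRpow (suc k) j) ∎
      where
      open ≋-Reasoning
      g : ℕ → Ser
      g k = cst (binom k)

    -- Truncated form of R · u (d/du) R^{-1/2} = α · u (dR/du) · R^{-1/2}.
    partialSum-ode : ∀ N j → partialEuler N j ⊕ mulR (partialEuler N) j
      ≋ cst α ⊛ (A₁ ⊛ partialSum N (ℤ.pred j) ⊕ two ⊛ (A₂ ⊛ partialSum N (ℤ.pred (ℤ.pred j)))) ⊕ kbinom N ⊛ dRpow (suc N) j
    partialSum-ode N j = begin
      partialEuler N j ⊕ mulR (partialEuler N) j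
        ≈⟨ same (partialEuler N j) ⊕≋ mulR-partialEuler N j ⟩
      partialEuler N j ⊕ ∑S N (λ k → H (suc k))
        ≈⟨ same (partialEuler N j) ⊕≋ ∑S-shift N H H₀ ⟩
      partialEuler N j ⊕ (∑S N H ⊕ H N)
        ≈⟨ solve 3 (λ a b c → a :+ (b :+ c) := (a :+ b) :+ c) ≋-refl (partialEuler N j) (∑S N H) (H N) ⟩
      (partialEuler N j ⊕ ∑S N H) ⊕ H N
        ≈⟨ ≋-sym (∑S-⊕ N (λ k → kbinom (suc k) ⊛ dRpow (suc k) j) H) ⊕≋ same (H N) ⟩
      ∑S N (λ k → kbinom (suc k) ⊛ dRpow (suc k) j ⊕ H k) ⊕ H N
        ≈⟨ ∑S-cong N (λ k → ≋-trans (solve 3 (λ a b e → a :* e :+ b :* e := (a :+ b) :* e) ≋-refl (kbinom (suc k)) (kbinom k) (dRpow (suc k) j))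
                                    (≋-trans (binom-recurrence k ⊛≋ same (dRpow (suc k) j))
                                             (solve 3 (λ a g e → (a :* g) :* e := a :* (g :* e)) ≋-refl (cst α) (cst (binom k)) (dRpow (suc k) j))))
           ⊕≋ same (H N) ⟩
      ∑S N (λ k → cst α ⊛ (cst (binom k) ⊛ dRpow (suc k) j)) ⊕ H N
        ≈⟨ ≋-sym (⊛-distribˡ-∑S N (cst α) (λ k → cst (binom k) ⊛ dRpow (suc k) j)) ⊕≋ same (H N) ⟩
      cst α ⊛ ∑S N (λ k → cst (binom k) ⊛ dRpow (suc k) j) ⊕ H N
        ≈⟨ same (cst α) ⊛≋ ≋-sym (dRpow-partialSum N j) ⊕≋ same (H N) ⟩
      cst α ⊛ (A₁ ⊛ partialSum N (ℤ.pred j) ⊕ two ⊛ (A₂ ⊛ partialSum N (ℤ.pred (ℤ.pred j)))) ⊕ H N ∎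
      where
      open ≋-Reasoning
      H : ℕ → Ser
      H k = kbinom k ⊛ dRpow (suc k) j
      H₀ : H 0 ≋ 0S
      H₀ = solve 1 (λ e → (con 1ℚ :* con 0ℚ) :* e := con 0ℚ) ≋-refl (dRpow 1 j)

    invSqrtR-partialSum : ∀ ℓ → invSqrtR R₁ R₂ ℓ ≋ partialSum (suc ℓ) (+ ℓ)
    invSqrtR-partialSum ℓ = ∑S-cong (suc ℓ) (λ k → ≋-trans (·-as-⊛ (binom k) ((Rm1 R₁ R₂ ^u k) ℓ))
                                                         (same (cst (binom k)) ⊛≋ Rm1-pow k ℓ))

    partialSum-stable : ∀ ℓ d → partialSum (d ℕ.+ suc ℓ) (+ ℓ) ≋ invSqrtR R₁ R₂ ℓ
    partialSum-stable ℓ d = ≋-trans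
      (∑S-extend (suc ℓ) d (λ k → cst (binom k) ⊛ Rpow k (+ ℓ))
                 (λ k ℓ<k → ≋-trans (same (cst (binom k)) ⊛≋ Rpow-below k ℓ ℓ<k)
                                    (solve 1 (λ g → g :* con 0ℚ := con 0ℚ) ≋-refl (cst (binom k)))))
      (≋-sym (invSqrtR-partialSum ℓ))

    private
      f = invSqrtR R₁ R₂

      euler-invSqrtR : ∀ ℓ d → partialEuler (d ℕ.+ ℓ) (+ ℓ) ≋ natS ℓ ⊛ f ℓ
      euler-invSqrtR ℓ d = ≋-sym (≋-trans (same (natS ℓ) ⊛≋ ≋-trans (≋-sym (partialSum-stable ℓ d))
                                                                     (≡⇒≋ (cong (λ M → partialSum M (+ ℓ)) (+-suc d ℓ))))
                                          (euler-partialSum (d ℕ.+ ℓ) (+ ℓ)))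

    invSqrtR-ode : ∀ ℓ → natS (2 ℕ.+ ℓ) ⊛ f (2 ℕ.+ ℓ) ⊕ (A₁ ⊛ (natS (suc ℓ) ⊛ f (suc ℓ)) ⊕ A₂ ⊛ (natS ℓ ⊛ f ℓ))
                       ≋ cst α ⊛ (A₁ ⊛ f (suc ℓ) ⊕ two ⊛ (A₂ ⊛ f ℓ))
    invSqrtR-ode ℓ = begin
      natS (2 ℕ.+ ℓ) ⊛ f (2 ℕ.+ ℓ) ⊕ (A₁ ⊛ (natS (suc ℓ) ⊛ f (suc ℓ)) ⊕ A₂ ⊛ (natS ℓ ⊛ f ℓ))
        ≈⟨ ≋-sym (euler-invSqrtR (2 ℕ.+ ℓ) 1 ⊕≋ (same A₁ ⊛≋ euler-invSqrtR (suc ℓ) 2 ⊕≋ same A₂ ⊛≋ euler-invSqrtR ℓ 3)) ⟩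
      partialEuler N (+ (2 ℕ.+ ℓ)) ⊕ mulR (partialEuler N) (+ (2 ℕ.+ ℓ))
        ≈⟨ partialSum-ode N (+ (2 ℕ.+ ℓ)) ⟩
      cst α ⊛ (A₁ ⊛ partialSum N (+ suc ℓ) ⊕ two ⊛ (A₂ ⊛ partialSum N (+ ℓ))) ⊕ kbinom N ⊛ dRpow (suc N) (+ (2 ℕ.+ ℓ))
        ≈⟨ same (cst α) ⊛≋ (same A₁ ⊛≋ partialSum-stable (suc ℓ) 1 ⊕≋ same two ⊛≋ (same A₂ ⊛≋ partialSum-stable ℓ 2))
           ⊕≋ same (kbinom N) ⊛≋ boundary ⟩
      cst α ⊛ (A₁ ⊛ f (suc ℓ) ⊕ two ⊛ (A₂ ⊛ f ℓ)) ⊕ kbinom N ⊛ 0S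
        ≈⟨ solve 2 (λ x k → x :+ k :* con 0ℚ := x) ≋-refl (cst α ⊛ (A₁ ⊛ f (suc ℓ) ⊕ two ⊛ (A₂ ⊛ f ℓ))) (kbinom N) ⟩
      cst α ⊛ (A₁ ⊛ f (suc ℓ) ⊕ two ⊛ (A₂ ⊛ f ℓ)) ∎
      where
      open ≋-Reasoning
      N = 3 ℕ.+ ℓ
      boundary : dRpow (suc N) (+ (2 ℕ.+ ℓ)) ≋ 0S
      boundary = ≋-trans (same A₁ ⊛≋ Rpow-below N (suc ℓ) (s≤s (m≤n+m (suc ℓ) 1))
                          ⊕≋ same two ⊛≋ (same A₂ ⊛≋ Rpow-below N ℓ (s≤s (m≤n+m ℓ 2))))
                         (solve 3 (λ a b c → a :* con 0ℚ :+ c :* (b :* con 0ℚ) := con 0ℚ) ≋-refl A₁ A₂ two)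

    -- The same three-term recurrence as the central coefficients, with S₁ = 2R₁ and S₂ = R₂ + R₁².
    invSqrtR-recurrence : ∀ ℓ → natS (2 ℕ.+ ℓ) ⊛ f (2 ℕ.+ ℓ)
      ≋ (cst (+ 4 / 1) ⊛ natS (suc ℓ) ⊕ two) ⊛ R₁ ⊛ f (suc ℓ) ⊕ cst (+ 4 / 1) ⊛ natS (suc ℓ) ⊛ R₂ ⊛ f ℓ
    invSqrtR-recurrence ℓ = begin
      X
        ≈⟨ solve 2 (λ x y → x := (x :+ y) :- y) ≋-refl X Y ⟩
      (X ⊕ Y) ⊖ Y
        ≈⟨ invSqrtR-ode ℓ ⊖≋ same Y ⟩
      cst α ⊛ (A₁ ⊛ f₁ ⊕ two ⊛ (A₂ ⊛ f₀)) ⊖ (A₁ ⊛ (natS (suc ℓ) ⊛ f₁) ⊕ A₂ ⊛ (natS ℓ ⊛ f₀))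
        ≈⟨ same (cst α) ⊛≋ (A₁≋ ⊛≋ same f₁ ⊕≋ same two ⊛≋ (A₂≋ ⊛≋ same f₀))
           ⊖≋ (A₁≋ ⊛≋ same (natS (suc ℓ) ⊛ f₁) ⊕≋ A₂≋ ⊛≋ same (natS ℓ ⊛ f₀)) ⟩
      cst α ⊛ (m4 ⊛ R₁ ⊛ f₁ ⊕ two ⊛ (m4 ⊛ R₂ ⊛ f₀)) ⊖ (m4 ⊛ R₁ ⊛ (natS (suc ℓ) ⊛ f₁) ⊕ m4 ⊛ R₂ ⊛ (natS ℓ ⊛ f₀))
        ≈⟨ solve 5 (λ L r₁ r₂ x y →
               con α :* (con (ℚ.- (+ 4 / 1)) :* r₁ :* x :+ con (+ 2 / 1) :* (con (ℚ.- (+ 4 / 1)) :* r₂ :* y))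
               :- (con (ℚ.- (+ 4 / 1)) :* r₁ :* ((L :+ con 1ℚ) :* x) :+ con (ℚ.- (+ 4 / 1)) :* r₂ :* (L :* y))
             := (con (+ 4 / 1) :* (L :+ con 1ℚ) :+ con (+ 2 / 1)) :* r₁ :* x :+ con (+ 4 / 1) :* (L :+ con 1ℚ) :* r₂ :* y)
             ≋-refl (natS ℓ) R₁ R₂ f₁ f₀ ⟩
      (cst (+ 4 / 1) ⊛ natS (suc ℓ) ⊕ two) ⊛ R₁ ⊛ f₁ ⊕ cst (+ 4 / 1) ⊛ natS (suc ℓ) ⊛ R₂ ⊛ f₀ ∎
      where
      open ≋-Reasoning
      m4 = cst (ℚ.- (+ 4 / 1))
      f₁ = f (suc ℓ)
      f₀ = f ℓ
      X = natS (2 ℕ.+ ℓ) ⊛ f (2 ℕ.+ ℓ)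
      Y = A₁ ⊛ (natS (suc ℓ) ⊛ f₁) ⊕ A₂ ⊛ (natS ℓ ⊛ f₀)
      A₁≋ : A₁ ≋ m4 ⊛ R₁
      A₁≋ = ·-as-⊛ (ℚ.- (+ 4 / 1)) R₁
      A₂≋ : A₂ ≋ m4 ⊛ R₂
      A₂≋ = ·-as-⊛ (ℚ.- (+ 4 / 1)) R₂

module Identification where

  open import Data.Nat as ℕ using (ℕ; zero; suc; _∸_)
  open import Data.Nat.Properties using (+-suc)
  open import Data.Integer using (+_)
  open import Data.Rational as ℚ using (0ℚ; 1ℚ; _/_)
  open import Data.Product using (_×_; _,_; proj₁)
  open import Relation.Binary.PropositionalEquality using (cong)
  open import Defs
  open SeriesRing
  open Scalars
  open ZSums
  open LaurentSeries
  open CentralCoefficients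
  open InverseSqrt
  open Solver

  module _ (R₁ R₂ S₁ S₂ : Ser) (S₁≋ : S₁ ≋ cst (+ 2 / 1) ⊛ R₁) (S₂≋ : S₂ ≋ R₂ ⊕ R₁ ⊛ R₁) where
    private
      f = invSqrtR R₁ R₂
      c = central S₁ S₂
      two four : Ser
      two  = cst (+ 2 / 1)
      four = cst (+ 4 / 1)

    invSqrtR-zero : f 0 ≋ c 0
    invSqrtR-zero = ≋-trans (invSqrtR-partialSum R₁ R₂ 0) (solve 0 (con 1ℚ :* con 1ℚ :+ con 0ℚ := con 1ℚ) ≋-refl)

    invSqrtR-one : f 1 ≋ c 1
    invSqrtR-one = begin
      f 1
        ≈⟨ invSqrtR-partialSum R₁ R₂ 1 ⟩
      cst 1ℚ ⊛ 0S ⊕ (cst (binom R₁ R₂ 1) ⊛ (A₁ R₁ R₂ ⊛ 1S ⊕ A₂ R₁ R₂ ⊛ 0S) ⊕ 0S)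
        ≈⟨ same (cst 1ℚ ⊛ 0S) ⊕≋ (same (cst (binom R₁ R₂ 1)) ⊛≋ (·-as-⊛ (ℚ.- (+ 4 / 1)) R₁ ⊛≋ same 1S ⊕≋ same (A₂ R₁ R₂ ⊛ 0S)) ⊕≋ same 0S) ⟩
      cst 1ℚ ⊛ 0S ⊕ (cst (binom R₁ R₂ 1) ⊛ (cst (ℚ.- (+ 4 / 1)) ⊛ R₁ ⊛ 1S ⊕ A₂ R₁ R₂ ⊛ 0S) ⊕ 0S)
        ≈⟨ solve 3 (λ r a₂ s → con 1ℚ :* con 0ℚ :+ (con (binom R₁ R₂ 1) :* (con (ℚ.- (+ 4 / 1)) :* r :* con 1ℚ :+ a₂ :* con 0ℚ) :+ con 0ℚ)
                                := con 0ℚ :+ con (+ 2 / 1) :* r :* con 1ℚ :+ s :* con 0ℚ)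
                   ≋-refl R₁ (A₂ R₁ R₂) S₂ ⟩
      0S ⊕ two ⊛ R₁ ⊛ 1S ⊕ S₂ ⊛ 0S
        ≈⟨ same 0S ⊕≋ ≋-sym S₁≋ ⊛≋ same 1S ⊕≋ same (S₂ ⊛ 0S) ⟩
      c 1 ∎
      where open ≋-Reasoning

    private
      invSqrtR≋central-pair : ∀ ℓ → (f ℓ ≋ c ℓ) × (f (suc ℓ) ≋ c (suc ℓ))
      invSqrtR≋central-pair zero    = invSqrtR-zero , invSqrtR-one
      invSqrtR≋central-pair (suc ℓ) with invSqrtR≋central-pair ℓ
      ... | e₀ , e₁ = e₁ , natS-cancel (suc ℓ) (begin
        natS (2 ℕ.+ ℓ) ⊛ f (2 ℕ.+ ℓ)
          ≈⟨ invSqrtR-recurrence R₁ R₂ ℓ ⟩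
        (four ⊛ M ⊕ two) ⊛ R₁ ⊛ f (suc ℓ) ⊕ four ⊛ M ⊛ R₂ ⊛ f ℓ
          ≈⟨ same ((four ⊛ M ⊕ two) ⊛ R₁) ⊛≋ e₁ ⊕≋ same (four ⊛ M ⊛ R₂) ⊛≋ e₀ ⟩
        (four ⊛ M ⊕ two) ⊛ R₁ ⊛ c (suc ℓ) ⊕ four ⊛ M ⊛ R₂ ⊛ c ℓ
          ≈⟨ solve 5 (λ M r₁ r₂ a b → (con (+ 4 / 1) :* M :+ con (+ 2 / 1)) :* r₁ :* a :+ con (+ 4 / 1) :* M :* r₂ :* b
                := (con (+ 2 / 1) :* M :+ con 1ℚ) :* (con (+ 2 / 1) :* r₁) :* a
                   :+ M :* (con (+ 4 / 1) :* (r₂ :+ r₁ :* r₁) :- (con (+ 2 / 1) :* r₁) :* (con (+ 2 / 1) :* r₁)) :* b)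
                ≋-refl M R₁ R₂ (c (suc ℓ)) (c ℓ) ⟩
        (two ⊛ M ⊕ 1S) ⊛ (two ⊛ R₁) ⊛ c (suc ℓ) ⊕ M ⊛ (four ⊛ (R₂ ⊕ R₁ ⊛ R₁) ⊖ (two ⊛ R₁) ⊛ (two ⊛ R₁)) ⊛ c ℓ
          ≈⟨ same (two ⊛ M ⊕ 1S) ⊛≋ ≋-sym S₁≋ ⊛≋ same (c (suc ℓ))
             ⊕≋ same M ⊛≋ (same four ⊛≋ ≋-sym S₂≋ ⊖≋ ≋-sym S₁≋ ⊛≋ ≋-sym S₁≋) ⊛≋ same (c ℓ) ⟩
        (two ⊛ M ⊕ 1S) ⊛ S₁ ⊛ c (suc ℓ) ⊕ M ⊛ (four ⊛ S₂ ⊖ S₁ ⊛ S₁) ⊛ c ℓ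
          ≈⟨ ≋-sym (central-recurrence S₁ S₂ ℓ) ⟩
        natS (2 ℕ.+ ℓ) ⊛ c (2 ℕ.+ ℓ) ∎)
        where
        open ≋-Reasoning
        M = natS (suc ℓ)

    invSqrtR≋central : ∀ ℓ → invSqrtR R₁ R₂ ℓ ≋ Ppow S₁ S₂ ℓ (+ 0)
    invSqrtR≋central ℓ = proj₁ (invSqrtR≋central-pair ℓ)

    Ppow-minus-one : ∀ m → two ⊛ Ppow S₁ S₂ m (neg 1) ≋ f (suc m) ⊖ S₁ ⊛ f m
    Ppow-minus-one m = begin
      two ⊛ Ppow S₁ S₂ m (neg 1)
        ≈⟨ same two ⊛≋ Ppow-symmetric S₁ S₂ m 1 ⟩
      two ⊛ ((S₂ ⊛ 1S) ⊛ u)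
        ≈⟨ solve 4 (λ s₁ s₂ u c → con (+ 2 / 1) :* ((s₂ :* con 1ℚ) :* u) := (s₁ :* c :+ con (+ 2 / 1) :* (s₂ :* u)) :- s₁ :* c)
                   ≋-refl S₁ S₂ u (c m) ⟩
      (S₁ ⊛ c m ⊕ two ⊛ (S₂ ⊛ u)) ⊖ S₁ ⊛ c m
        ≈⟨ ≋-sym (central-suc S₁ S₂ m) ⊖≋ same S₁ ⊛≋ same (c m) ⟩
      c (suc m) ⊖ S₁ ⊛ c m
        ≈⟨ ≋-sym (invSqrtR≋central (suc m)) ⊖≋ same S₁ ⊛≋ ≋-sym (invSqrtR≋central m) ⟩
      f (suc m) ⊖ S₁ ⊛ f m ∎
      where
      open ≋-Reasoning
      u = Ppow S₁ S₂ m (+ 1)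

    betaR≋PkW : ∀ ℓ → betaR R₁ R₂ ℓ ≋ PkW S₁ S₂ (suc ℓ) (+ 0)
    betaR≋PkW ℓ = ≋-trans
      (zSum-cong (λ i → f (ℓ ℕ.+ i)) (λ i → Ppow S₁ S₂ (suc ℓ ℕ.+ (i ∸ 1)) (+ 0))
                 (λ i → ≋-trans (invSqrtR≋central (ℓ ℕ.+ suc i)) (≡⇒≋ (cong (λ k → Ppow S₁ S₂ k (+ 0)) (+-suc ℓ i)))))
      (≋-sym (PkW-as-zSum S₁ S₂ (suc ℓ) (+ 0)))

module Moments where

  open import Data.Nat using (ℕ)
  open import Data.Integer using (+_)
  open import Data.Rational using (ℚ; 1ℚ; ½; _/_; -_)
  open import Defs
  open SeriesRing
  open LaurentSeries
  open Solver

  -- Instantiated with the series operations and with the solver syntax; module parameters carry no fixity.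
  module Expressions {A : Set} (_+_ _*_ _-_ : A → A → A) (κ : ℚ → A) (t s₁ s₂ w₀ w₁ w₂ w₃ : A) where

    two : A
    two = κ (+ 2 / 1)

    -- [v⁰]PW, [v¹]PW, [v²]PW, [v⁰]P²W, [v¹]P²W, [v⁰]P³W in terms of wₙ = [vⁿ]W, using the symmetry of W.
    PW₀ PW₁ PW₂ P²W₀ P²W₁ P³W₀ : A
    PW₀  = (s₁ * w₀) + (two * (s₂ * w₁))
    PW₁  = (w₀ + (s₁ * w₁)) + (s₂ * w₂)
    PW₂  = (w₁ + (s₁ * w₂)) + (s₂ * w₃)
    P²W₀ = (s₁ * PW₀) + (two * (s₂ * PW₁))
    P²W₁ = (PW₀ + (s₁ * PW₁)) + (s₂ * PW₂)
    P³W₀ = (s₁ * P²W₀) + (two * (s₂ * P²W₁))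

    r₁ r₂ : A
    r₁ = κ ½ * s₁
    r₂ = s₂ - (r₁ * r₁)

    lhs rhs : A
    lhs = ((s₂ * (((κ (+ 3 / 1) * r₂) + (κ (+ 15 / 1) * (r₁ * r₁))) - (two * t))) + ((t * r₁) * P²W₀)) - (κ ½ * (t * P³W₀))
    rhs = t * ((((s₁ * s₁) + s₂) - (two * (s₁ * ((s₂ * (s₂ * κ 1ℚ)) * w₂)))) - ((s₂ * (s₂ * (s₂ * κ 1ℚ))) * w₃))

    k₀ k₁ : A
    k₀ = κ (- (+ 2 / 1)) * (s₁ * s₂)
    k₁ = κ (- 1ℚ) * ((κ (+ 3 / 1) * s₂) + (s₁ * s₁))

  module SerExpressions = Expressions _⊕_ _⊛_ _⊖_ cst

  module _ (S₁ S₂ : Ser) where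
    private
      w : ℕ → Ser
      w n = W S₁ S₂ (+ n)
      module E = SerExpressions tS S₁ S₂ (w 0) (w 1) (w 2) (w 3)

    PW₀-expansion : PkW S₁ S₂ 1 (+ 0) ≋ E.PW₀
    PW₀-expansion = mulP-constant S₁ S₂ (W S₁ S₂) (W-symmetric S₁ S₂)

    P²W₀-expansion : PkW S₁ S₂ 2 (+ 0) ≋ E.P²W₀
    P²W₀-expansion = ≋-trans (mulP-constant S₁ S₂ (PkW S₁ S₂ 1) (PkW-symmetric S₁ S₂ 1))
                             (same S₁ ⊛≋ PW₀-expansion ⊕≋ same (E.two ⊛ (S₂ ⊛ E.PW₁)))

    P³W₀-expansion : PkW S₁ S₂ 3 (+ 0) ≋ E.P³W₀
    P³W₀-expansion = ≋-trans (mulP-constant S₁ S₂ (PkW S₁ S₂ 2) (PkW-symmetric S₁ S₂ 2))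
      (same S₁ ⊛≋ P²W₀-expansion ⊕≋ same E.two ⊛≋ (same S₂ ⊛≋ (PW₀-expansion ⊕≋ same (S₁ ⊛ E.PW₁) ⊕≋ same (S₂ ⊛ E.PW₂))))

  -- The substitutions [v⁰]W = S₁/t and [v⁻¹]W = (S₂ − t)/t of the paper, without dividing by t.
  moment-identity : ∀ t s₁ s₂ w₀ w₁ w₂ w₃ → t ⊛ w₀ ≋ s₁ → t ⊛ (s₂ ⊛ w₁) ≋ s₂ ⊖ t →
                    SerExpressions.lhs t s₁ s₂ w₀ w₁ w₂ w₃ ≋ SerExpressions.rhs t s₁ s₂ w₀ w₁ w₂ w₃
  moment-identity t s₁ s₂ w₀ w₁ w₂ w₃ e₀ e₁ = begin
    E.lhs
      ≈⟨ solve 7 (λ t s₁ s₂ w₀ w₁ w₂ w₃ →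
                   let open Expressions _:+_ _:*_ _:-_ con t s₁ s₂ w₀ w₁ w₂ w₃
                   in lhs := rhs :+ k₁ :* (t :* (s₂ :* w₁) :- (s₂ :- t)) :+ k₀ :* (t :* w₀ :- s₁))
                 ≋-refl t s₁ s₂ w₀ w₁ w₂ w₃ ⟩
    E.rhs ⊕ E.k₁ ⊛ (t ⊛ (s₂ ⊛ w₁) ⊖ (s₂ ⊖ t)) ⊕ E.k₀ ⊛ (t ⊛ w₀ ⊖ s₁)
      ≈⟨ same E.rhs ⊕≋ same E.k₁ ⊛≋ (e₁ ⊖≋ same (s₂ ⊖ t)) ⊕≋ same E.k₀ ⊛≋ (e₀ ⊖≋ same s₁) ⟩
    E.rhs ⊕ E.k₁ ⊛ ((s₂ ⊖ t) ⊖ (s₂ ⊖ t)) ⊕ E.k₀ ⊛ (s₁ ⊖ s₁)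
      ≈⟨ solve 5 (λ r k₁ k₀ y s → r :+ k₁ :* (y :- y) :+ k₀ :* (s :- s) := r) ≋-refl E.rhs E.k₁ E.k₀ (s₂ ⊖ t) s₁ ⟩
    E.rhs ∎
    where
    open ≋-Reasoning
    module E = SerExpressions t s₁ s₂ w₀ w₁ w₂ w₃

open import Data.Nat using (ℕ; suc; _∸_)
open import Data.Integer using (ℤ; +_; pred)
import Data.Integer
open import Data.Rational as ℚ using (1ℚ; ½; _/_)
open import Data.Product using (_×_; _,_; proj₁; proj₂)
open import Relation.Binary.PropositionalEquality using (refl)
open import Defs
open SeriesRing
open ZSums
open Uniqueness
open LaurentSeries
open Identification
open Moments
open Solver

module SolutionFromR (R₁ R₂ : Ser)
  (hR₁ : R₁ ≋ ½ · (tS ⊛ zSum (λ i → invSqrtR R₁ R₂ (i ∸ 1))))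
  (hR₂ : R₂ ≋ tS ⊖ (+ 3 / 1) · (R₁ ⊛ R₁) ⊕ ½ · (tS ⊛ zSum (λ i → invSqrtR R₁ R₂ i))) where

  private
    Z₀ Z₁ two minus-one half : Ser
    Z₀ = zSum (λ i → invSqrtR R₁ R₂ (i ∸ 1))
    Z₁ = zSum (λ i → invSqrtR R₁ R₂ i)
    two = cst (+ 2 / 1)
    minus-one = cst (ℚ.- 1ℚ)
    half = cst ½

  S₁ᴿ S₂ᴿ : Ser
  S₁ᴿ = (+ 2 / 1) · R₁
  S₂ᴿ = R₂ ⊕ R₁ ⊛ R₁

  S₁ᴿ≋ : S₁ᴿ ≋ two ⊛ R₁
  S₁ᴿ≋ = ·-as-⊛ (+ 2 / 1) R₁

  private
    t⊛Z₀ : tS ⊛ Z₀ ≋ two ⊛ R₁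
    t⊛Z₀ = ≋-sym (≋-trans (same two ⊛≋ ≋-trans hR₁ (·-as-⊛ ½ (tS ⊛ Z₀)))
                          (solve 1 (λ x → con (+ 2 / 1) :* (con ½ :* x) := x) ≋-refl (tS ⊛ Z₀)))

    W₀≋Z₀ : W S₁ᴿ S₂ᴿ (+ 0) ≋ Z₀
    W₀≋Z₀ = zSum-cong (λ i → Ppow S₁ᴿ S₂ᴿ (i ∸ 1) (+ 0)) (λ i → invSqrtR R₁ R₂ (i ∸ 1))
                      (λ i → ≋-sym (invSqrtR≋central R₁ R₂ S₁ᴿ S₂ᴿ S₁ᴿ≋ ≋-refl i))

    two⊛W₋₁ : two ⊛ W S₁ᴿ S₂ᴿ (neg 1) ≋ Z₁ ⊕ minus-one ⊛ (S₁ᴿ ⊛ Z₀)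
    two⊛W₋₁ = begin
      two ⊛ W S₁ᴿ S₂ᴿ (neg 1)
        ≈⟨ ⊛-zSum two (λ i → Ppow S₁ᴿ S₂ᴿ (i ∸ 1) (neg 1)) ⟩
      zSum (λ i → two ⊛ Ppow S₁ᴿ S₂ᴿ (i ∸ 1) (neg 1))
        ≈⟨ zSum-cong (λ i → two ⊛ Ppow S₁ᴿ S₂ᴿ (i ∸ 1) (neg 1)) (λ i → f i ⊕ minus-one ⊛ (S₁ᴿ ⊛ f (i ∸ 1)))
             (λ i → ≋-trans (Ppow-minus-one R₁ R₂ S₁ᴿ S₂ᴿ S₁ᴿ≋ ≋-refl i)
                            (solve 3 (λ a s b → a :- s :* b := a :+ con (ℚ.- 1ℚ) :* (s :* b)) ≋-refl (f (suc i)) S₁ᴿ (f i))) ⟩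
      zSum (λ i → f i ⊕ minus-one ⊛ (S₁ᴿ ⊛ f (i ∸ 1)))
        ≈⟨ zSum-⊕ f (λ i → minus-one ⊛ (S₁ᴿ ⊛ f (i ∸ 1))) ⟩
      Z₁ ⊕ zSum (λ i → minus-one ⊛ (S₁ᴿ ⊛ f (i ∸ 1)))
        ≈⟨ same Z₁ ⊕≋ ≋-sym (≋-trans (same minus-one ⊛≋ ⊛-zSum S₁ᴿ (λ i → f (i ∸ 1)))
                                     (⊛-zSum minus-one (λ i → S₁ᴿ ⊛ f (i ∸ 1)))) ⟩
      Z₁ ⊕ minus-one ⊛ (S₁ᴿ ⊛ Z₀) ∎
      where
      open ≋-Reasoning
      f = invSqrtR R₁ R₂

  S₁ᴿ-equation : S₁ᴿ ≋ tS ⊛ W S₁ᴿ S₂ᴿ (+ 0)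
  S₁ᴿ-equation = ≋-trans S₁ᴿ≋ (≋-trans (≋-sym t⊛Z₀) (same tS ⊛≋ ≋-sym W₀≋Z₀))

  S₂ᴿ-equation : S₂ᴿ ≋ tS ⊕ tS ⊛ W S₁ᴿ S₂ᴿ (neg 1)
  S₂ᴿ-equation = begin
    R₂ ⊕ R₁ ⊛ R₁
      ≈⟨ ≋-trans hR₂ (same tS ⊖≋ ·-as-⊛ (+ 3 / 1) (R₁ ⊛ R₁) ⊕≋ ·-as-⊛ ½ (tS ⊛ Z₁)) ⊕≋ same (R₁ ⊛ R₁) ⟩
    (tS ⊖ cst (+ 3 / 1) ⊛ (R₁ ⊛ R₁) ⊕ half ⊛ (tS ⊛ Z₁)) ⊕ R₁ ⊛ R₁
      ≈⟨ solve 3 (λ t r z → (t :- con (+ 3 / 1) :* (r :* r) :+ con ½ :* (t :* z)) :+ r :* r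
                            := t :+ con ½ :* (t :* z) :+ con (ℚ.- 1ℚ) :* (r :* (con (+ 2 / 1) :* r))) ≋-refl tS R₁ Z₁ ⟩
    tS ⊕ half ⊛ (tS ⊛ Z₁) ⊕ minus-one ⊛ (R₁ ⊛ (two ⊛ R₁))
      ≈⟨ same (tS ⊕ half ⊛ (tS ⊛ Z₁)) ⊕≋ same minus-one ⊛≋ (same R₁ ⊛≋ ≋-sym t⊛Z₀) ⟩
    tS ⊕ half ⊛ (tS ⊛ Z₁) ⊕ minus-one ⊛ (R₁ ⊛ (tS ⊛ Z₀))
      ≈⟨ solve 4 (λ t z₁ r z₀ → t :+ con ½ :* (t :* z₁) :+ con (ℚ.- 1ℚ) :* (r :* (t :* z₀))
                                := t :+ con ½ :* (t :* (z₁ :+ con (ℚ.- 1ℚ) :* ((con (+ 2 / 1) :* r) :* z₀)))) ≋-refl tS Z₁ R₁ Z₀ ⟩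
    tS ⊕ half ⊛ (tS ⊛ (Z₁ ⊕ minus-one ⊛ ((two ⊛ R₁) ⊛ Z₀)))
      ≈⟨ same tS ⊕≋ same half ⊛≋ (same tS ⊛≋ (same Z₁ ⊕≋ same minus-one ⊛≋ (≋-sym S₁ᴿ≋ ⊛≋ same Z₀))) ⟩
    tS ⊕ half ⊛ (tS ⊛ (Z₁ ⊕ minus-one ⊛ (S₁ᴿ ⊛ Z₀)))
      ≈⟨ same tS ⊕≋ same half ⊛≋ (same tS ⊛≋ ≋-sym two⊛W₋₁) ⟩
    tS ⊕ half ⊛ (tS ⊛ (two ⊛ W S₁ᴿ S₂ᴿ (neg 1)))
      ≈⟨ solve 2 (λ t w → t :+ con ½ :* (t :* (con (+ 2 / 1) :* w)) := t :+ t :* w) ≋-refl tS (W S₁ᴿ S₂ᴿ (neg 1)) ⟩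
    tS ⊕ tS ⊛ W S₁ᴿ S₂ᴿ (neg 1) ∎
    where open ≋-Reasoning

module _ (R₁ R₂ S₁ S₂ : Ser) (S₁≋ : S₁ ≋ cst (+ 2 / 1) ⊛ R₁) (S₂≋ : S₂ ≋ R₂ ⊕ R₁ ⊛ R₁)
         (hS₁ : S₁ ≋ tS ⊛ W S₁ S₂ (+ 0)) (hS₂ : S₂ ≋ tS ⊕ tS ⊛ W S₁ S₂ (neg 1)) where

  private
    w : ℕ → Ser
    w n = W S₁ S₂ (+ n)
    module E = SerExpressions tS S₁ S₂ (w 0) (w 1) (w 2) (w 3)
    half = cst ½

    R₁≋ : R₁ ≋ half ⊛ S₁
    R₁≋ = ≋-sym (≋-trans (same half ⊛≋ S₁≋) (solve 1 (λ r → con ½ :* (con (+ 2 / 1) :* r) := r) ≋-refl R₁))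

    R₂≋ : R₂ ≋ S₂ ⊖ (half ⊛ S₁) ⊛ (half ⊛ S₁)
    R₂≋ = ≋-trans (solve 2 (λ a b → a := (a :+ b :* b) :- b :* b) ≋-refl R₂ R₁) (≋-sym S₂≋ ⊖≋ R₁≋ ⊛≋ R₁≋)

    t⊛S₂⊛w₁ : tS ⊛ (S₂ ⊛ w 1) ≋ S₂ ⊖ tS
    t⊛S₂⊛w₁ = begin
      tS ⊛ (S₂ ⊛ w 1)                 ≈⟨ solve 3 (λ t s w → t :* (s :* w) := (t :+ t :* ((s :* con 1ℚ) :* w)) :- t) ≋-refl tS S₂ (w 1) ⟩
      (tS ⊕ tS ⊛ ((S₂ ⊛ 1S) ⊛ w 1)) ⊖ tS ≈⟨ (same tS ⊕≋ same tS ⊛≋ ≋-sym (W-symmetric S₁ S₂ 1)) ⊖≋ same tS ⟩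
      (tS ⊕ tS ⊛ W S₁ S₂ (neg 1)) ⊖ tS  ≈⟨ ≋-sym hS₂ ⊖≋ same tS ⟩
      S₂ ⊖ tS                          ∎
      where open ≋-Reasoning

  moment-formula :
    (R₂ ⊕ R₁ ⊛ R₁) ⊛ ((+ 3 / 1) · R₂ ⊕ (+ 15 / 1) · (R₁ ⊛ R₁) ⊖ (+ 2 / 1) · tS)
      ⊕ tS ⊛ R₁ ⊛ betaR R₁ R₂ 1 ⊖ ½ · (tS ⊛ betaR R₁ R₂ 2)
    ≋ tS ⊛ (S₁ ⊛ S₁ ⊕ S₂ ⊖ (+ 2 / 1) · (S₁ ⊛ W S₁ S₂ (neg 2)) ⊖ W S₁ S₂ (neg 3))
  moment-formula = begin
    (R₂ ⊕ R₁ ⊛ R₁) ⊛ ((+ 3 / 1) · R₂ ⊕ (+ 15 / 1) · (R₁ ⊛ R₁) ⊖ (+ 2 / 1) · tS)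
      ⊕ tS ⊛ R₁ ⊛ betaR R₁ R₂ 1 ⊖ ½ · (tS ⊛ betaR R₁ R₂ 2)
      ≈⟨ ≋-sym S₂≋ ⊛≋ (≋-trans (·-as-⊛ (+ 3 / 1) R₂) (same (cst (+ 3 / 1)) ⊛≋ R₂≋)
                       ⊕≋ ≋-trans (·-as-⊛ (+ 15 / 1) (R₁ ⊛ R₁)) (same (cst (+ 15 / 1)) ⊛≋ (R₁≋ ⊛≋ R₁≋))
                       ⊖≋ ·-as-⊛ (+ 2 / 1) tS)
         ⊕≋ same tS ⊛≋ R₁≋ ⊛≋ ≋-trans (betaR≋PkW R₁ R₂ S₁ S₂ S₁≋ S₂≋ 1) (P²W₀-expansion S₁ S₂)
         ⊖≋ ≋-trans (·-as-⊛ ½ (tS ⊛ betaR R₁ R₂ 2))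
                    (same half ⊛≋ (same tS ⊛≋ ≋-trans (betaR≋PkW R₁ R₂ S₁ S₂ S₁≋ S₂≋ 2) (P³W₀-expansion S₁ S₂))) ⟩
    E.lhs
      ≈⟨ moment-identity tS S₁ S₂ (w 0) (w 1) (w 2) (w 3) (≋-sym hS₁) t⊛S₂⊛w₁ ⟩
    E.rhs
      ≈⟨ same tS ⊛≋ (same (S₁ ⊛ S₁ ⊕ S₂)
                     ⊖≋ ≋-trans (·-as-⊛ (+ 2 / 1) (S₁ ⊛ W S₁ S₂ (neg 2))) (same E.two ⊛≋ (same S₁ ⊛≋ W-symmetric S₁ S₂ 2))
                     ⊖≋ W-symmetric S₁ S₂ 3) ⟨
    tS ⊛ (S₁ ⊛ S₁ ⊕ S₂ ⊖ (+ 2 / 1) · (S₁ ⊛ W S₁ S₂ (neg 2)) ⊖ W S₁ S₂ (neg 3)) ∎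
    where open ≋-Reasoning

proposition10p3 : (R₁ R₂ S₁ S₂ : Ser)
    → R₁ ≈ ½ · (tS ⊛ zSum (λ i → invSqrtR R₁ R₂ (i ∸ 1)))
    → R₂ ≈ tS ⊖ (+ 3 / 1) · (R₁ ⊛ R₁) ⊕ ½ · (tS ⊛ zSum (λ i → invSqrtR R₁ R₂ i))
    → S₁ ≈ tS ⊛ W S₁ S₂ (+ 0)
    → S₂ ≈ tS ⊕ tS ⊛ W S₁ S₂ (neg 1)
    → ((S₁ ≈ (+ 2 / 1) · R₁)
       × (S₂ ≈ R₂ ⊕ R₁ ⊛ R₁)
       × (∀ (ℓ : ℕ) → betaR R₁ R₂ ℓ ≈ PkW S₁ S₂ (suc ℓ) (+ 0)))
     × ((∀ (k : ℕ) (j : ℤ) → PkW S₁ S₂ (suc k) j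
                             ≈ PkW S₁ S₂ k (pred j) ⊕ S₁ ⊛ PkW S₁ S₂ k j ⊕ S₂ ⊛ PkW S₁ S₂ k (Data.Integer.suc j))
       × (∀ (k n : ℕ) → PkW S₁ S₂ k (neg n) ≈ (S₂ ^S n) ⊛ PkW S₁ S₂ k (+ n)))
     × ((R₂ ⊕ R₁ ⊛ R₁) ⊛ ((+ 3 / 1) · R₂ ⊕ (+ 15 / 1) · (R₁ ⊛ R₁) ⊖ (+ 2 / 1) · tS)
          ⊕ tS ⊛ R₁ ⊛ betaR R₁ R₂ 1 ⊖ ½ · (tS ⊛ betaR R₁ R₂ 2)
        ≈ tS ⊛ (S₁ ⊛ S₁ ⊕ S₂ ⊖ (+ 2 / 1) · (S₁ ⊛ W S₁ S₂ (neg 2)) ⊖ W S₁ S₂ (neg 3)))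
proposition10p3 R₁ R₂ S₁ S₂ hR₁ hR₂ hS₁ hS₂ =
    (un S₁≋S₁ᴿ , un S₂≋S₂ᴿ , λ ℓ → un (betaR≋PkW R₁ R₂ S₁ S₂ S₁≋ S₂≋S₂ᴿ ℓ))
  , ((λ k j _ _ → refl) , λ k n → un (PkW-symmetric S₁ S₂ k n))
  , un (moment-formula R₁ R₂ S₁ S₂ S₁≋ S₂≋S₂ᴿ (mk hS₁) (mk hS₂))
  where
  open SolutionFromR R₁ R₂ (mk hR₁) (mk hR₂)
  S≋Sᴿ : (S₁ ≋ S₁ᴿ) × (S₂ ≋ S₂ᴿ)
  S≋Sᴿ = S-system-unique (mk hS₁) (mk hS₂) S₁ᴿ-equation S₂ᴿ-equation
  S₁≋S₁ᴿ : S₁ ≋ S₁ᴿ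
  S₁≋S₁ᴿ = proj₁ S≋Sᴿ
  S₂≋S₂ᴿ : S₂ ≋ S₂ᴿ
  S₂≋S₂ᴿ = proj₂ S≋Sᴿ
  S₁≋ : S₁ ≋ cst (+ 2 / 1) ⊛ R₁
  S₁≋ = ≋-trans S₁≋S₁ᴿ S₁ᴿ≋
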